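{- Let $V_n$ be the $n$th straight ménage number and $U_n$ the $n$th ordinary ménage number (with $V_0=U_0=1$), and let $c(x)=\sum_{k\ge0}C_kx^k$ be the generating function of the Catalan numbers $C_k=\frac{(2k)!}{k!\,(k+1)!}$. Then, as formal power series in $x$, \[ \sum_{n=0}^{\infty}n!\,x^n=\sum_{n=0}^\infty V_nx^nc(x)^{2n+1}, \qquad \sum_{n=0}^{\infty}n!\,x^n=c(x)+c'(x)\sum_{n=1}^\infty U_nx^nc(x)^{2n-2}. \]
   Context: For $n\ge1$, a permutation $\pi$ of $[n]=\{1,\dots,n\}$ is a straight ménage permutation if $\pi(i)\ne i$ and $\pi(i)\ne i+1$ for all $1\le i\le n$; it is an ordinary ménage permutation if $\pi(i)\ne i$ and $\pi(i)\not\equiv i+1 \pmod n$ for all $1\le i\le n$. $V_n$ (resp. $U_n$) is the number of straight (resp. ordinary) ménage permutations of $[n]$ for $n\ge1$; by convention the empty permutation of $S_0$ is both, so $V_0=U_0=1$. $c'(x)$ denotes the formal derivative of $c(x)$. -}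

module Defs where

open import Data.Nat.Base using (ℕ; zero; suc; _+_; _*_; _∸_; _/_; _!; _≡ᵇ_; _≤ᵇ_)
open import Data.Nat.Properties using (_!*_!≢0)
open import Data.Bool.Base using (Bool; true; false; _∧_; _∨_; not; if_then_else_)
open import Data.Product.Base using (_×_; _,_)
open import Data.List.Base using (List; []; _∷_; concatMap; map; filterᵇ; length; upTo; zip)
open import Data.Bool.ListAction using (and)

-- Formal power series with natural-number coefficients:
-- a series is its coefficient sequence, f k = [x^k] f.

Series : Set
Series = ℕ → ℕ

sumTo : ℕ → (ℕ → ℕ) → ℕ
sumTo zero    g = g zero
sumTo (suc m) g = sumTo m g + g (suc m)

infixl 7 _⊛_
_⊛_ : Series → Series → Series
(f ⊛ g) m = sumTo m (λ i → f i * g (m ∸ i))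

infixl 6 _⊕_
_⊕_ : Series → Series → Series
(f ⊕ g) m = f m + g m

infixr 7 _∙_
_∙_ : ℕ → Series → Series
(a ∙ f) m = a * f m

one : Series
one zero    = 1
one (suc _) = 0

infixr 8 _^ˢ_
_^ˢ_ : Series → ℕ → Series
f ^ˢ zero  = one
f ^ˢ suc n = f ⊛ (f ^ˢ n)

xPow : ℕ → Series → Series
xPow n f m = if n ≤ᵇ m then f (m ∸ n) else 0

deriv : Series → Series
deriv f k = suc k * f (suc k)

-- Infinite sum  Σ_{n≥0} xPow n (F n)  of a family whose n-th term is
-- divisible by x^n: only n ≤ m contributes to the coefficient of x^m,
-- so the family is formally summable and this is its sum.
sumXFamily : (ℕ → Series) → Series
sumXFamily F m = sumTo m (λ n → xPow n (F n) m)

sumXFamily₁ : (ℕ → Series) → Series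
sumXFamily₁ F m = sumTo m (λ n → if n ≡ᵇ 0 then 0 else xPow n (F n) m)

catalan : ℕ → ℕ
catalan k = ((2 * k) !) / (k ! * (suc k) !)
  where instance _ = k !* (suc k) !≢0

c : Series
c = catalan

factSeries : Series
factSeries n = n !

-- Permutations of [n], encoded 0-based: a permutation π of {0,…,n-1}
-- is the list [π(0), …, π(n-1)].  allPerms n lists each exactly once.

insertions : ℕ → List ℕ → List (List ℕ)
insertions x []       = (x ∷ []) ∷ []
insertions x (y ∷ ys) = (x ∷ y ∷ ys) ∷ map (y ∷_) (insertions x ys)

perms : List ℕ → List (List ℕ)
perms []       = [] ∷ []
perms (x ∷ xs) = concatMap (insertions x) (perms xs)

allPerms : ℕ → List (List ℕ)
allPerms n = perms (upTo n)

graph : List ℕ → List (ℕ × ℕ)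
graph π = zip (upTo (length π)) π

isStraight : List ℕ → Bool
isStraight π = and (map ok (graph π))
  where
  ok : ℕ × ℕ → Bool
  ok (i , p) = not (p ≡ᵇ i) ∧ not (p ≡ᵇ suc i)

isOrdinary : List ℕ → Bool
isOrdinary π = and (map ok (graph π))
  where
  n = length π
  succMod : ℕ → ℕ
  succMod i = if suc i ≡ᵇ n then 0 else suc i
  ok : ℕ × ℕ → Bool
  ok (i , p) = not (p ≡ᵇ i) ∧ not (p ≡ᵇ succMod i)

V : ℕ → ℕ
V n = length (filterᵇ isStraight (allPerms n))

U : ℕ → ℕ
U n = length (filterᵇ isOrdinary (allPerms n))

module Submission where

-- Both identities are proved for integer-valued power series, into which the
-- natural-number series of the statement embed coefficientwise.
--
-- The closed form gives (k+2) C_{k+1} = 2(2k+1) C_k,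
--   hence Segner's recurrence, i.e. c = 1 + x c².  Consequently
--   c' (2 - c) = c³, and c^a Q_a = 1 for Q_a = Σ_k (-1)ᵏ (a+k-1 choose k) xᵏ c^{2k}
--   (the expansion of (1 + x c²)^{-a}).
-- * Rook theory.  For any board h, Σ_π ∏ᵢ (1 + z [h(i, πᵢ)]) = Σ_k zᵏ r_k (n-k)!,
--   where r_k counts k non-attacking rooks on h.  At z = -1 this is
--   inclusion–exclusion; the rook numbers of the straight and ordinary ménage
--   boards are path numbers, giving V_n and U_n as alternating sums.
-- * Substituting these sums, regrouping the double sums by n - k, and
--   applying the Catalan identities collapses both right-hand sides to Σ n! xⁿ.

module CatalanNumbers where

  open import Data.Nat.Base
  open import Data.Nat.Properties
  open import Data.Nat.DivMod using (m*n/n≡m; m/n*n≡m)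
  open import Data.Nat.Combinatorics using (_C_; k![n∸k]!∣n!)
  open import Data.Nat.Combinatorics.Specification using (nCk≡n!/k![n-k]!)
  open import Data.Nat.Tactic.RingSolver using (solve-∀)
  open import Relation.Binary.PropositionalEquality
  open ≡-Reasoning
  open import Defs using (catalan)

  binomial-factorials : ∀ {n k} → k ≤ n → (n C k) * (k ! * (n ∸ k) !) ≡ n !
  binomial-factorials {n} {k} k≤n =
    trans (cong (_* (k ! * (n ∸ k) !)) (nCk≡n!/k![n-k]! k≤n)) (m/n*n≡m (k![n∸k]!∣n! k≤n))
    where instance _ = k !* (n ∸ k) !≢0

  -- The division in the definition of C_k is exact: for k ≥ 1,
  -- C_k = (2k choose k) - (2k choose k+1) and both binomials clear the denominator.
  catalan-factorials : ∀ k → catalan k * (k ! * (suc k) !) ≡ (2 * k) !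
  catalan-factorials zero    = refl
  catalan-factorials (suc j) = trans (cong (_* P) catalan≡difference) difference-clears
    where
    k = suc j
    n = 2 * k
    P = k ! * (suc k) !
    instance _ = k !* (suc k) !≢0
    n∸k : n ∸ k ≡ k
    n∸k = trans (m+n∸m≡n k (k + 0)) (+-identityʳ k)
    n≡ : ∀ j → 2 * suc j ≡ suc (suc j) + j
    n≡ = solve-∀
    n∸[k+1] : n ∸ suc k ≡ j
    n∸[k+1] = trans (cong (_∸ suc k) (n≡ j)) (m+n∸m≡n (suc k) j)
    k+1≤n : suc k ≤ n
    k+1≤n = subst (suc k ≤_) (sym (n≡ j)) (m≤m+n (suc k) j)
    central : (n C k) * P ≡ n ! * suc k
    central = begin
      (n C k) * (k ! * (suc k * k !))          ≡⟨ rearrange (n C k) (k !) (suc k) ⟩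
      (n C k) * (k ! * k !) * suc k            ≡⟨ cong (λ t → (n C k) * (k ! * t !) * suc k) (sym n∸k) ⟩
      (n C k) * (k ! * (n ∸ k) !) * suc k      ≡⟨ cong (_* suc k) (binomial-factorials (m≤m+n k (k + 0))) ⟩
      n ! * suc k                              ∎
      where
      rearrange : ∀ a b c → a * (b * (c * b)) ≡ a * (b * b) * c
      rearrange = solve-∀
    next : (n C suc k) * P ≡ n ! * k
    next = begin
      (n C suc k) * (k ! * (suc k) !)                  ≡⟨ rearrange (n C suc k) (j !) k ((suc k) !) ⟩
      (n C suc k) * ((suc k) ! * j !) * k              ≡⟨ cong (λ t → (n C suc k) * ((suc k) ! * t !) * k) (sym n∸[k+1]) ⟩
      (n C suc k) * ((suc k) ! * (n ∸ suc k) !) * k    ≡⟨ cong (_* k) (binomial-factorials k+1≤n) ⟩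
      n ! * k                                          ∎
      where
      rearrange : ∀ a b c d → a * ((c * b) * d) ≡ a * (d * b) * c
      rearrange = solve-∀
    difference-clears : ((n C k) ∸ (n C suc k)) * P ≡ n !
    difference-clears = begin
      ((n C k) ∸ (n C suc k)) * P        ≡⟨ *-distribʳ-∸ P (n C k) (n C suc k) ⟩
      (n C k) * P ∸ (n C suc k) * P      ≡⟨ cong₂ _∸_ central next ⟩
      n ! * suc k ∸ n ! * k              ≡⟨ sym (*-distribˡ-∸ (n !) (suc k) k) ⟩
      n ! * (suc k ∸ k)                  ≡⟨ cong (n ! *_) (m+n∸n≡m 1 k) ⟩
      n ! * 1                            ≡⟨ *-identityʳ (n !) ⟩
      n !                                ∎
    catalan≡difference : catalan k ≡ (n C k) ∸ (n C suc k)
    catalan≡difference = trans (cong (_/ P) (sym difference-clears)) (m*n/n≡m ((n C k) ∸ (n C suc k)) P)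

  -- (k+2) C_{k+1} = 2 (2k+1) C_k, after cancelling (k+1) k! (k+1)! from both sides.
  catalan-recurrence : ∀ k → (2 + k) * catalan (suc k) ≡ 2 * (1 + 2 * k) * catalan k
  catalan-recurrence k = *-cancelʳ-≡ _ _ Q multiplied
    where
    P = k ! * (suc k) !
    Q = suc k * P
    instance _ = m*n≢0 (suc k) P {{_}} {{k !* (suc k) !≢0}}
    multiplied : (2 + k) * catalan (suc k) * Q ≡ 2 * (1 + 2 * k) * catalan k * Q
    multiplied = begin
      (2 + k) * catalan (suc k) * (suc k * (k ! * (suc k) !))
        ≡⟨ regroup (catalan (suc k)) k (k !) ⟩
      catalan (suc k) * ((suc k) ! * (suc (suc k)) !)
        ≡⟨ catalan-factorials (suc k) ⟩
      (2 * suc k) !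
        ≡⟨ cong _! (double-suc k) ⟩
      (2 + 2 * k) * ((1 + 2 * k) * (2 * k) !)
        ≡⟨ cong (λ t → (2 + 2 * k) * ((1 + 2 * k) * t)) (sym (catalan-factorials k)) ⟩
      (2 + 2 * k) * ((1 + 2 * k) * (catalan k * (k ! * (suc k) !)))
        ≡⟨ regroup′ (catalan k) k (k !) ((suc k) !) ⟩
      2 * (1 + 2 * k) * catalan k * (suc k * (k ! * (suc k) !)) ∎
      where
      regroup : ∀ c k a → (2 + k) * c * (suc k * (a * (suc k * a))) ≡ c * ((suc k * a) * ((2 + k) * (suc k * a)))
      regroup = solve-∀
      double-suc : ∀ k → 2 * suc k ≡ 2 + 2 * k
      double-suc = solve-∀
      regroup′ : ∀ c k a b → (2 + 2 * k) * ((1 + 2 * k) * (c * (a * b))) ≡ 2 * (1 + 2 * k) * c * (suc k * (a * b))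
      regroup′ = solve-∀

module Proof where

  open import Data.Nat.Base as N using (ℕ; zero; suc; _∸_; _≤_; _<_; z≤n; s≤s; _!; _≡ᵇ_; _≤ᵇ_)
  import Data.Nat.Properties as NP
  open import Data.Integer.Base using (ℤ; +_; -_; _+_; _*_; _-_; _^_; -1ℤ)
  import Data.Integer.Properties as ZP
  open import Data.Integer.Tactic.RingSolver using (solve-∀)
  open import Data.Bool.Base using (Bool; true; false; _∧_; _∨_; not; T; if_then_else_)
  open import Data.Bool.Properties using (∨-zeroʳ)
  open import Data.List.Base using (List; []; _∷_; _++_; map; concatMap; length; filterᵇ; applyUpTo; upTo; zip)
  open import Data.List.Relation.Unary.All using (All; []; _∷_)
  open import Data.Bool.ListAction using (and)
  open import Data.Product.Base using (_×_; _,_)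
  open import Data.Unit.Base using (tt)
  open import Data.Empty using (⊥-elim)
  open import Function.Base using (_∘_)
  open import Relation.Binary.PropositionalEquality
  import Relation.Binary.Reasoning.Setoid as SetoidReasoning
  open CatalanNumbers using (catalan-recurrence)
  open import Defs using (catalan; insertions; perms; V; U; isStraight; isOrdinary)
  import Defs

  Σ : ℕ → (ℕ → ℤ) → ℤ
  Σ zero    f = f zero
  Σ (suc m) f = Σ m f + f (suc m)

  Σ-cong-≤ : ∀ m {f g : ℕ → ℤ} → (∀ i → i ≤ m → f i ≡ g i) → Σ m f ≡ Σ m g
  Σ-cong-≤ zero    h = h 0 z≤n
  Σ-cong-≤ (suc m) h = cong₂ _+_ (Σ-cong-≤ m (λ i i≤m → h i (NP.m≤n⇒m≤1+n i≤m))) (h (suc m) NP.≤-refl)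

  Σ-cong : ∀ m {f g : ℕ → ℤ} → f ≗ g → Σ m f ≡ Σ m g
  Σ-cong m h = Σ-cong-≤ m (λ i _ → h i)

  Σ-+ : ∀ m (f g : ℕ → ℤ) → Σ m (λ i → f i + g i) ≡ Σ m f + Σ m g
  Σ-+ zero    f g = refl
  Σ-+ (suc m) f g rewrite Σ-+ m f g = interchange (Σ m f) (Σ m g) (f (suc m)) (g (suc m))
    where
    interchange : ∀ a b c d → a + b + (c + d) ≡ a + c + (b + d)
    interchange = solve-∀

  Σ-*ˡ : ∀ m a (f : ℕ → ℤ) → a * Σ m f ≡ Σ m (λ i → a * f i)
  Σ-*ˡ zero    a f = refl
  Σ-*ˡ (suc m) a f = trans (ZP.*-distribˡ-+ a (Σ m f) (f (suc m))) (cong (_+ a * f (suc m)) (Σ-*ˡ m a f))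

  Σ-*ʳ : ∀ m a (f : ℕ → ℤ) → Σ m f * a ≡ Σ m (λ i → f i * a)
  Σ-*ʳ m a f = trans (ZP.*-comm (Σ m f) a) (trans (Σ-*ˡ m a f) (Σ-cong m (λ i → ZP.*-comm a (f i))))

  Σ-neg : ∀ m (f : ℕ → ℤ) → - Σ m f ≡ Σ m (λ i → - f i)
  Σ-neg zero    f = refl
  Σ-neg (suc m) f = trans (ZP.neg-distrib-+ (Σ m f) (f (suc m))) (cong (_+ - f (suc m)) (Σ-neg m f))

  Σ-head : ∀ m (f : ℕ → ℤ) → Σ (suc m) f ≡ f 0 + Σ m (λ i → f (suc i))
  Σ-head zero    f = refl
  Σ-head (suc m) f rewrite Σ-head m f = ZP.+-assoc (f 0) (Σ m (λ i → f (suc i))) (f (suc (suc m)))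

  Σ-rev : ∀ m (f : ℕ → ℤ) → Σ m f ≡ Σ m (λ i → f (m ∸ i))
  Σ-rev zero    f = refl
  Σ-rev (suc m) f = begin
    Σ m f + f (suc m)                       ≡⟨ cong (_+ f (suc m)) (Σ-rev m f) ⟩
    Σ m (λ i → f (m ∸ i)) + f (suc m)       ≡⟨ ZP.+-comm (Σ m (λ i → f (m ∸ i))) (f (suc m)) ⟩
    f (suc m) + Σ m (λ i → f (m ∸ i))       ≡⟨ sym (Σ-head m (λ i → f (suc m ∸ i))) ⟩
    Σ (suc m) (λ i → f (suc m ∸ i))         ∎
    where open ≡-Reasoning

  Σ-single : ∀ m (f : ℕ → ℤ) → (∀ i → 0 < i → f i ≡ + 0) → Σ m f ≡ f 0
  Σ-single zero    f h = refl
  Σ-single (suc m) f h = trans (cong₂ _+_ (Σ-single m f h) (h (suc m) (s≤s z≤n))) (ZP.+-identityʳ (f 0))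

  Σ-zero : ∀ m (f : ℕ → ℤ) → (∀ i → f i ≡ + 0) → Σ m f ≡ + 0
  Σ-zero m f h = trans (Σ-single m f (λ i _ → h i)) (h 0)

  Σ-triangle : ∀ m (F : ℕ → ℕ → ℤ) →
    Σ m (λ n → Σ n (λ k → F n k)) ≡ Σ m (λ k → Σ (m ∸ k) (λ j → F (k N.+ j) k))
  Σ-triangle zero    F = refl
  Σ-triangle (suc m) F = begin
    Σ m (λ n → Σ n (F n)) + Σ (suc m) (F (suc m))
      ≡⟨ cong (_+ Σ (suc m) (F (suc m))) (Σ-triangle m F) ⟩
    Σ m column + (Σ m (F (suc m)) + F (suc m) (suc m))
      ≡⟨ sym (ZP.+-assoc (Σ m column) (Σ m (F (suc m))) (F (suc m) (suc m))) ⟩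
    Σ m column + Σ m (F (suc m)) + F (suc m) (suc m)
      ≡⟨ cong₂ _+_ (sym (Σ-+ m column (F (suc m)))) (cong (λ t → F t (suc m)) (sym (NP.+-identityʳ (suc m)))) ⟩
    Σ m (λ k → column k + F (suc m) k) + F (suc m N.+ 0) (suc m)
      ≡⟨ cong (_+ F (suc m N.+ 0) (suc m)) (Σ-cong-≤ m extend) ⟩
    Σ m column′ + Σ 0 (λ j → F (suc m N.+ j) (suc m))
      ≡⟨ cong (λ t → Σ m column′ + Σ t (λ j → F (suc m N.+ j) (suc m))) (sym (NP.n∸n≡0 m)) ⟩
    Σ (suc m) column′ ∎
    where
    open ≡-Reasoning
    column column′ : ℕ → ℤ
    column  k = Σ (m ∸ k) (λ j → F (k N.+ j) k)
    column′ k = Σ (suc m ∸ k) (λ j → F (k N.+ j) k)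
    extend : ∀ k → k ≤ m → column k + F (suc m) k ≡ column′ k
    extend k k≤m rewrite NP.+-∸-assoc 1 k≤m =
      cong (λ t → column k + F t k) (trans (sym (NP.m+[n∸m]≡n (NP.m≤n⇒m≤1+n k≤m))) (cong (k N.+_) (NP.+-∸-assoc 1 k≤m)))

  Σ-swap : ∀ m (F : ℕ → ℕ → ℤ) →
    Σ m (λ i → Σ (m ∸ i) (λ j → F i j)) ≡ Σ m (λ j → Σ (m ∸ j) (λ i → F i j))
  Σ-swap m F = begin
    Σ m (λ i → Σ (m ∸ i) (λ j → F i j))   ≡⟨ antidiagonals F ⟩
    Σ m (λ n → Σ n (λ i → F i (n ∸ i)))   ≡⟨ Σ-cong m (λ n → trans (Σ-rev n _) (Σ-cong-≤ n (λ j j≤n → cong (F (n ∸ j)) (NP.m∸[m∸n]≡n j≤n)))) ⟩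
    Σ m (λ n → Σ n (λ j → F (n ∸ j) j))   ≡⟨ sym (antidiagonals (λ j i → F i j)) ⟩
    Σ m (λ j → Σ (m ∸ j) (λ i → F i j))   ∎
    where
    open ≡-Reasoning
    antidiagonals : ∀ G → Σ m (λ i → Σ (m ∸ i) (G i)) ≡ Σ m (λ n → Σ n (λ i → G i (n ∸ i)))
    antidiagonals G = sym (trans (Σ-triangle m (λ n i → G i (n ∸ i)))
      (Σ-cong m (λ k → Σ-cong (m ∸ k) (λ j → cong (G k) (NP.m+n∸m≡n k j)))))

  Σ-by-difference : ∀ m (H : ℕ → ℕ → ℤ) →
    Σ m (λ n → Σ n (H n)) ≡ Σ m (λ j → Σ (m ∸ j) (λ k → H (k N.+ j) k))
  Σ-by-difference m H = trans (Σ-triangle m H) (Σ-swap m (λ k j → H (k N.+ j) k))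

  Ser : Set
  Ser = ℕ → ℤ

  infix 4 _≈_
  _≈_ : Ser → Ser → Set
  f ≈ g = ∀ m → f m ≡ g m

  ≈-refl : ∀ {f} → f ≈ f
  ≈-refl m = refl

  ≈-sym : ∀ {f g} → f ≈ g → g ≈ f
  ≈-sym p m = sym (p m)

  ≈-trans : ∀ {f g h} → f ≈ g → g ≈ h → f ≈ h
  ≈-trans p q m = trans (p m) (q m)

  module ≈-Reasoning = SetoidReasoning (ℕ →-setoid ℤ)

  infixl 7 _⊛_
  infixl 6 _⊕_ _⊖_
  infixr 7 _·_
  infixr 8 _^ˢ_

  _⊛_ : Ser → Ser → Ser
  (f ⊛ g) m = Σ m (λ i → f i * g (m ∸ i))

  _⊕_ : Ser → Ser → Ser
  (f ⊕ g) m = f m + g m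

  _⊖_ : Ser → Ser → Ser
  (f ⊖ g) m = f m - g m

  _·_ : ℤ → Ser → Ser
  (a · f) m = a * f m

  oneS : Ser
  oneS zero    = + 1
  oneS (suc _) = + 0

  zeroS : Ser
  zeroS _ = + 0

  X : Ser → Ser
  X f zero    = + 0
  X f (suc m) = f m

  _^ˢ_ : Ser → ℕ → Ser
  f ^ˢ zero  = oneS
  f ^ˢ suc n = f ⊛ (f ^ˢ n)

  -- The formally summable family Σₙ xⁿ Fₙ.
  SX : (ℕ → Ser) → Ser
  SX F m = Σ m (λ n → F n (m ∸ n))

  ∂ : Ser → Ser
  ∂ f k = + suc k * f (suc k)

  ⊛-cong : ∀ {f f′ g g′} → f ≈ f′ → g ≈ g′ → f ⊛ g ≈ f′ ⊛ g′
  ⊛-cong p q m = Σ-cong m (λ i → cong₂ _*_ (p i) (q (m ∸ i)))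

  ⊛-congˡ : ∀ {f f′} g → f ≈ f′ → f ⊛ g ≈ f′ ⊛ g
  ⊛-congˡ g p = ⊛-cong p (≈-refl {g})

  ⊛-congʳ : ∀ f {g g′} → g ≈ g′ → f ⊛ g ≈ f ⊛ g′
  ⊛-congʳ f q = ⊛-cong (≈-refl {f}) q

  ⊕-cong : ∀ {f f′ g g′} → f ≈ f′ → g ≈ g′ → f ⊕ g ≈ f′ ⊕ g′
  ⊕-cong p q m = cong₂ _+_ (p m) (q m)

  ·-cong : ∀ a {f g} → f ≈ g → a · f ≈ a · g
  ·-cong a p m = cong (a *_) (p m)

  X-cong : ∀ {f g} → f ≈ g → X f ≈ X g
  X-cong p zero    = refl
  X-cong p (suc m) = p m

  SX-cong : ∀ {F G} → (∀ n → F n ≈ G n) → SX F ≈ SX G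
  SX-cong p m = Σ-cong m (λ n → p n (m ∸ n))

  ⊛-comm : ∀ f g → f ⊛ g ≈ g ⊛ f
  ⊛-comm f g m = trans (Σ-rev m _) (Σ-cong-≤ m (λ i i≤m →
    trans (ZP.*-comm (f (m ∸ i)) (g (m ∸ (m ∸ i)))) (cong (λ j → g j * f (m ∸ i)) (NP.m∸[m∸n]≡n i≤m))))

  ⊛-assoc : ∀ f g h → (f ⊛ g) ⊛ h ≈ f ⊛ (g ⊛ h)
  ⊛-assoc f g h m = begin
    Σ m (λ i → Σ i (λ j → f j * g (i ∸ j)) * h (m ∸ i))
      ≡⟨ Σ-cong m (λ i → Σ-*ʳ i (h (m ∸ i)) _) ⟩
    Σ m (λ i → Σ i (λ j → f j * g (i ∸ j) * h (m ∸ i)))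
      ≡⟨ Σ-triangle m (λ i j → f j * g (i ∸ j) * h (m ∸ i)) ⟩
    Σ m (λ j → Σ (m ∸ j) (λ t → f j * g ((j N.+ t) ∸ j) * h (m ∸ (j N.+ t))))
      ≡⟨ Σ-cong m (λ j → trans (Σ-cong (m ∸ j) (reassociate j)) (sym (Σ-*ˡ (m ∸ j) (f j) _))) ⟩
    Σ m (λ j → f j * Σ (m ∸ j) (λ t → g t * h (m ∸ j ∸ t))) ∎
    where
    open ≡-Reasoning
    reassociate : ∀ j t → f j * g ((j N.+ t) ∸ j) * h (m ∸ (j N.+ t)) ≡ f j * (g t * h (m ∸ j ∸ t))
    reassociate j t = trans (cong₂ (λ a b → f j * g a * h b) (NP.m+n∸m≡n j t) (sym (NP.∸-+-assoc m j t)))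
                            (ZP.*-assoc (f j) (g t) (h (m ∸ j ∸ t)))

  ⊛-lcomm : ∀ f g h → f ⊛ (g ⊛ h) ≈ g ⊛ (f ⊛ h)
  ⊛-lcomm f g h = begin
    f ⊛ (g ⊛ h)  ≈⟨ ≈-sym (⊛-assoc f g h) ⟩
    (f ⊛ g) ⊛ h  ≈⟨ ⊛-congˡ h (⊛-comm f g) ⟩
    (g ⊛ f) ⊛ h  ≈⟨ ⊛-assoc g f h ⟩
    g ⊛ (f ⊛ h)  ∎
    where open ≈-Reasoning

  ⊛-distribʳ : ∀ f g h → (f ⊕ g) ⊛ h ≈ f ⊛ h ⊕ g ⊛ h
  ⊛-distribʳ f g h m = trans (Σ-cong m (λ i → ZP.*-distribʳ-+ (h (m ∸ i)) (f i) (g i))) (Σ-+ m _ _)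

  ⊛-distribˡ : ∀ f g h → h ⊛ (f ⊕ g) ≈ h ⊛ f ⊕ h ⊛ g
  ⊛-distribˡ f g h m = begin
    (h ⊛ (f ⊕ g)) m          ≡⟨ ⊛-comm h (f ⊕ g) m ⟩
    ((f ⊕ g) ⊛ h) m          ≡⟨ ⊛-distribʳ f g h m ⟩
    (f ⊛ h) m + (g ⊛ h) m    ≡⟨ cong₂ _+_ (⊛-comm f h m) (⊛-comm g h m) ⟩
    (h ⊛ f ⊕ h ⊛ g) m        ∎
    where open ≡-Reasoning

  ⊛-distribʳ-⊖ : ∀ f g h → (f ⊖ g) ⊛ h ≈ f ⊛ h ⊖ g ⊛ h
  ⊛-distribʳ-⊖ f g h m = begin
    Σ m (λ i → (f i - g i) * h (m ∸ i))
      ≡⟨ Σ-cong m (λ i → trans (ZP.*-distribʳ-+ (h (m ∸ i)) (f i) (- g i)) (cong (λ t → f i * h (m ∸ i) + t) (sym (ZP.neg-distribˡ-* (g i) (h (m ∸ i)))))) ⟩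
    Σ m (λ i → f i * h (m ∸ i) + - (g i * h (m ∸ i)))
      ≡⟨ Σ-+ m _ _ ⟩
    (f ⊛ h) m + Σ m (λ i → - (g i * h (m ∸ i)))
      ≡⟨ cong (λ t → (f ⊛ h) m + t) (sym (Σ-neg m _)) ⟩
    (f ⊛ h ⊖ g ⊛ h) m ∎
    where open ≡-Reasoning

  ⊛-distribˡ-⊖ : ∀ f g h → h ⊛ (f ⊖ g) ≈ h ⊛ f ⊖ h ⊛ g
  ⊛-distribˡ-⊖ f g h m = begin
    (h ⊛ (f ⊖ g)) m          ≡⟨ ⊛-comm h (f ⊖ g) m ⟩
    ((f ⊖ g) ⊛ h) m          ≡⟨ ⊛-distribʳ-⊖ f g h m ⟩
    (f ⊛ h) m - (g ⊛ h) m    ≡⟨ cong₂ _-_ (⊛-comm f h m) (⊛-comm g h m) ⟩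
    (h ⊛ f ⊖ h ⊛ g) m        ∎
    where open ≡-Reasoning

  ·-⊛ : ∀ a f g → (a · f) ⊛ g ≈ a · (f ⊛ g)
  ·-⊛ a f g m = trans (Σ-cong m (λ i → ZP.*-assoc a (f i) (g (m ∸ i)))) (sym (Σ-*ˡ m a _))

  ⊛-· : ∀ a f g → f ⊛ (a · g) ≈ a · (f ⊛ g)
  ⊛-· a f g m = begin
    (f ⊛ (a · g)) m     ≡⟨ ⊛-comm f (a · g) m ⟩
    ((a · g) ⊛ f) m     ≡⟨ ·-⊛ a g f m ⟩
    a * (g ⊛ f) m       ≡⟨ cong (a *_) (⊛-comm g f m) ⟩
    a * (f ⊛ g) m       ∎
    where open ≡-Reasoning

  ·-distribʳ : ∀ a b f → (a + b) · f ≈ a · f ⊕ b · f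
  ·-distribʳ a b f m = ZP.*-distribʳ-+ (f m) a b

  ·-assoc : ∀ a b f → (a * b) · f ≈ a · (b · f)
  ·-assoc a b f m = ZP.*-assoc a b (f m)

  one-⊛ : ∀ f → oneS ⊛ f ≈ f
  one-⊛ f m = trans (Σ-single m _ higher) (ZP.*-identityˡ (f m))
    where
    higher : ∀ i → 0 < i → oneS i * f (m ∸ i) ≡ + 0
    higher (suc i) _ = ZP.*-zeroˡ (f (m ∸ suc i))

  ⊛-one : ∀ f → f ⊛ oneS ≈ f
  ⊛-one f m = trans (⊛-comm f oneS m) (one-⊛ f m)

  ^ˢ-+ : ∀ f a b → f ^ˢ (a N.+ b) ≈ f ^ˢ a ⊛ f ^ˢ b
  ^ˢ-+ f zero    b = ≈-sym (one-⊛ (f ^ˢ b))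
  ^ˢ-+ f (suc a) b = begin
    f ⊛ f ^ˢ (a N.+ b)       ≈⟨ ⊛-congʳ f (^ˢ-+ f a b) ⟩
    f ⊛ (f ^ˢ a ⊛ f ^ˢ b)    ≈⟨ ≈-sym (⊛-assoc f (f ^ˢ a) (f ^ˢ b)) ⟩
    f ⊛ f ^ˢ a ⊛ f ^ˢ b      ∎
    where open ≈-Reasoning

  X-⊛ : ∀ f g → X f ⊛ g ≈ X (f ⊛ g)
  X-⊛ f g zero    = refl
  X-⊛ f g (suc m) = trans (Σ-head m _) (ZP.+-identityˡ _)

  ⊛-X : ∀ f g → f ⊛ X g ≈ X (f ⊛ g)
  ⊛-X f g = begin
    f ⊛ X g      ≈⟨ ⊛-comm f (X g) ⟩
    X g ⊛ f      ≈⟨ X-⊛ g f ⟩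
    X (g ⊛ f)    ≈⟨ X-cong (⊛-comm g f) ⟩
    X (f ⊛ g)    ∎
    where open ≈-Reasoning

  X-· : ∀ a f → X (a · f) ≈ a · X f
  X-· a f zero    = sym (ZP.*-zeroʳ a)
  X-· a f (suc m) = refl

  SX-⊛ : ∀ F g → SX F ⊛ g ≈ SX (λ n → F n ⊛ g)
  SX-⊛ F g m = begin
    Σ m (λ i → Σ i (λ n → F n (i ∸ n)) * g (m ∸ i))
      ≡⟨ Σ-cong m (λ i → Σ-*ʳ i (g (m ∸ i)) _) ⟩
    Σ m (λ i → Σ i (λ n → F n (i ∸ n) * g (m ∸ i)))
      ≡⟨ Σ-triangle m _ ⟩
    Σ m (λ n → Σ (m ∸ n) (λ t → F n ((n N.+ t) ∸ n) * g (m ∸ (n N.+ t))))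
      ≡⟨ Σ-cong m (λ n → Σ-cong (m ∸ n) (λ t → cong₂ (λ a b → F n a * g b) (NP.m+n∸m≡n n t) (sym (NP.∸-+-assoc m n t)))) ⟩
    Σ m (λ n → Σ (m ∸ n) (λ t → F n t * g (m ∸ n ∸ t))) ∎
    where open ≡-Reasoning

  SX-⊕ : ∀ F G → SX (λ n → F n ⊕ G n) ≈ SX F ⊕ SX G
  SX-⊕ F G m = Σ-+ m _ _

  SX-· : ∀ a F → SX (λ n → a · F n) ≈ a · SX F
  SX-· a F m = sym (Σ-*ˡ m a _)

  SX-split : ∀ F → SX F ≈ F 0 ⊕ X (SX (λ n → F (suc n)))
  SX-split F zero    = sym (ZP.+-identityʳ (F 0 0))
  SX-split F (suc m) = Σ-head m _

  SX-single : ∀ F → (∀ n → F (suc n) ≈ zeroS) → SX F ≈ F 0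
  SX-single F h m = Σ-single m _ (λ { (suc n) _ → h n (m ∸ suc n) })

  ∂-cong : ∀ {f g} → f ≈ g → ∂ f ≈ ∂ g
  ∂-cong p k = cong (+ suc k *_) (p (suc k))

  ∂-⊕ : ∀ f g → ∂ (f ⊕ g) ≈ ∂ f ⊕ ∂ g
  ∂-⊕ f g k = ZP.*-distribˡ-+ (+ suc k) (f (suc k)) (g (suc k))

  ∂-one : ∂ oneS ≈ zeroS
  ∂-one k = ZP.*-zeroʳ (+ suc k)

  ∂-X : ∀ f → ∂ (X f) ≈ f ⊕ X (∂ f)
  ∂-X f zero    = trans (ZP.*-identityˡ (f 0)) (sym (ZP.+-identityʳ (f 0)))
  ∂-X f (suc k) = begin
    + suc (suc k) * f (suc k)                 ≡⟨ cong (_* f (suc k)) (sym (ZP.pos-+ 1 (suc k))) ⟩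
    (+ 1 + + suc k) * f (suc k)               ≡⟨ ZP.*-distribʳ-+ (f (suc k)) (+ 1) (+ suc k) ⟩
    + 1 * f (suc k) + + suc k * f (suc k)     ≡⟨ cong (_+ + suc k * f (suc k)) (ZP.*-identityˡ (f (suc k))) ⟩
    f (suc k) + + suc k * f (suc k)           ∎
    where open ≡-Reasoning

  -- Leibniz rule: the weight k+1 of a term f_i g_{k+1-i} splits as i + (k+1-i).
  ∂-⊛ : ∀ f g → ∂ (f ⊛ g) ≈ ∂ f ⊛ g ⊕ f ⊛ ∂ g
  ∂-⊛ f g k = begin
    + suc k * Σ (suc k) term
      ≡⟨ Σ-*ˡ (suc k) (+ suc k) term ⟩
    Σ (suc k) (λ i → + suc k * term i)
      ≡⟨ Σ-cong-≤ (suc k) split-weight ⟩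
    Σ (suc k) (λ i → + i * term i + + (suc k ∸ i) * term i)
      ≡⟨ Σ-+ (suc k) _ _ ⟩
    Σ (suc k) (λ i → + i * term i) + Σ (suc k) (λ i → + (suc k ∸ i) * term i)
      ≡⟨ cong₂ _+_ left-factor right-factor ⟩
    (∂ f ⊛ g) k + (f ⊛ ∂ g) k ∎
    where
    open ≡-Reasoning
    term : ℕ → ℤ
    term i = f i * g (suc k ∸ i)
    split-weight : ∀ i → i ≤ suc k → + suc k * term i ≡ + i * term i + + (suc k ∸ i) * term i
    split-weight i i≤ = trans (cong (λ t → + t * term i) (sym (NP.m+[n∸m]≡n i≤)))
                       (trans (cong (_* term i) (ZP.pos-+ i (suc k ∸ i))) (ZP.*-distribʳ-+ (term i) (+ i) (+ (suc k ∸ i))))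
    left-factor : Σ (suc k) (λ i → + i * term i) ≡ (∂ f ⊛ g) k
    left-factor = begin
      Σ (suc k) (λ i → + i * term i)
        ≡⟨ Σ-head k _ ⟩
      + 0 * term 0 + Σ k (λ i → + suc i * term (suc i))
        ≡⟨ cong (_+ Σ k (λ i → + suc i * term (suc i))) (ZP.*-zeroˡ (term 0)) ⟩
      + 0 + Σ k (λ i → + suc i * term (suc i))
        ≡⟨ ZP.+-identityˡ _ ⟩
      Σ k (λ i → + suc i * (f (suc i) * g (k ∸ i)))
        ≡⟨ Σ-cong k (λ i → sym (ZP.*-assoc (+ suc i) (f (suc i)) (g (k ∸ i)))) ⟩
      (∂ f ⊛ g) k ∎
    right-factor : Σ (suc k) (λ i → + (suc k ∸ i) * term i) ≡ (f ⊛ ∂ g) k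
    right-factor = begin
      Σ k (λ i → + (suc k ∸ i) * term i) + + (suc k ∸ suc k) * term (suc k)
        ≡⟨ cong (λ t → Σ k (λ i → + (suc k ∸ i) * term i) + t * term (suc k)) (cong +_ (NP.n∸n≡0 k)) ⟩
      Σ k (λ i → + (suc k ∸ i) * term i) + + 0 * term (suc k)
        ≡⟨ cong (λ t → Σ k (λ i → + (suc k ∸ i) * term i) + t) (ZP.*-zeroˡ (term (suc k))) ⟩
      Σ k (λ i → + (suc k ∸ i) * term i) + + 0
        ≡⟨ ZP.+-identityʳ _ ⟩
      Σ k (λ i → + (suc k ∸ i) * term i)
        ≡⟨ Σ-cong-≤ k (λ i i≤k → trans (cong (λ t → + t * (f i * g t)) (NP.+-∸-assoc 1 i≤k))
                                        (swap (+ suc (k ∸ i)) (f i) (g (suc (k ∸ i))))) ⟩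
      (f ⊛ ∂ g) k ∎
      where
      swap : ∀ a b c → a * (b * c) ≡ b * (a * c)
      swap = solve-∀

  c : Ser
  c k = + catalan k

  catalan-recurrenceℤ : ∀ k → (+ 2 + + k) * c (suc k) ≡ (+ 2 + + 4 * + k) * c k
  catalan-recurrenceℤ k = begin
    (+ 2 + + k) * c (suc k)                   ≡⟨ sym (ZP.pos-* (2 N.+ k) (catalan (suc k))) ⟩
    + ((2 N.+ k) N.* catalan (suc k))         ≡⟨ cong +_ (catalan-recurrence k) ⟩
    + (2 N.* (1 N.+ 2 N.* k) N.* catalan k)   ≡⟨ ZP.pos-* (2 N.* (1 N.+ 2 N.* k)) (catalan k) ⟩
    + (2 N.* (1 N.+ 2 N.* k)) * c k           ≡⟨ cong (_* c k) (coefficient k) ⟩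
    (+ 2 + + 4 * + k) * c k                   ∎
    where
    open ≡-Reasoning
    coefficient : ∀ k → + (2 N.* (1 N.+ 2 N.* k)) ≡ + 2 + + 4 * + k
    coefficient k = trans (cong +_ (ℕ-solve k)) (trans (ZP.pos-+ 2 (4 N.* k)) (cong (λ t → + 2 + t) (ZP.pos-* 4 k)))
      where
      ℕ-solve : ∀ k → 2 N.* (1 N.+ 2 N.* k) ≡ 2 N.+ 4 N.* k
      ℕ-solve k = trans (NP.*-distribˡ-+ 2 1 (2 N.* k)) (cong (2 N.+_) (sym (NP.*-assoc 2 2 k)))

  moment : ℕ → ℤ
  moment k = Σ k (λ i → + suc i * (c i * c (k ∸ i)))

  -- Reversing the sum and averaging: 2 T_k = (k+2) (c ⊛ c)_k.
  moment-symmetry : ∀ k → + 2 * moment k ≡ (+ 2 + + k) * (c ⊛ c) k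
  moment-symmetry k = begin
    + 2 * moment k
      ≡⟨ double (moment k) ⟩
    moment k + moment k
      ≡⟨ cong (λ t → moment k + t) (trans (Σ-rev k _) (Σ-cong-≤ k reflect)) ⟩
    moment k + Σ k (λ i → + suc (k ∸ i) * (c i * c (k ∸ i)))
      ≡⟨ sym (Σ-+ k _ _) ⟩
    Σ k (λ i → + suc i * (c i * c (k ∸ i)) + + suc (k ∸ i) * (c i * c (k ∸ i)))
      ≡⟨ Σ-cong-≤ k (λ i i≤k → trans (sym (ZP.*-distribʳ-+ _ (+ suc i) (+ suc (k ∸ i)))) (cong (_* (c i * c (k ∸ i))) (weights i i≤k))) ⟩
    Σ k (λ i → (+ 2 + + k) * (c i * c (k ∸ i)))
      ≡⟨ sym (Σ-*ˡ k (+ 2 + + k) (λ i → c i * c (k ∸ i))) ⟩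
    (+ 2 + + k) * (c ⊛ c) k ∎
    where
    open ≡-Reasoning
    double : ∀ t → + 2 * t ≡ t + t
    double = solve-∀
    reflect : ∀ i → i ≤ k → + suc (k ∸ i) * (c (k ∸ i) * c (k ∸ (k ∸ i))) ≡ + suc (k ∸ i) * (c i * c (k ∸ i))
    reflect i i≤k = cong (+ suc (k ∸ i) *_) (trans (cong (λ j → c (k ∸ i) * c j) (NP.m∸[m∸n]≡n i≤k)) (ZP.*-comm (c (k ∸ i)) (c i)))
    weights : ∀ i → i ≤ k → + suc i + + suc (k ∸ i) ≡ + 2 + + k
    weights i i≤k = cong +_ (trans (cong suc (NP.+-suc i (k ∸ i))) (cong (λ t → suc (suc t)) (NP.m+[n∸m]≡n i≤k)))

  -- Feeding the recurrence for C_{i+1} into T_{k+1}.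
  moment-suc : ∀ k → moment (suc k) ≡ c (suc k) + (+ 2 * (+ 2 + + k) * (c ⊛ c) k - + 2 * (c ⊛ c) k)
  moment-suc k = begin
    moment (suc k)
      ≡⟨ Σ-head k _ ⟩
    + 1 * (c 0 * c (suc k)) + Σ k (λ j → + suc (suc j) * (c (suc j) * c (k ∸ j)))
      ≡⟨ cong₂ _+_ (unit (c (suc k))) (Σ-cong k recur) ⟩
    c (suc k) + Σ k (λ j → + 4 * (+ suc j * (c j * c (k ∸ j))) - + 2 * (c j * c (k ∸ j)))
      ≡⟨ cong (λ t → c (suc k) + t) (Σ-+ k _ _) ⟩
    c (suc k) + (Σ k (λ j → + 4 * (+ suc j * (c j * c (k ∸ j)))) + Σ k (λ j → - (+ 2 * (c j * c (k ∸ j)))))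
      ≡⟨ cong (λ t → c (suc k) + t) (cong₂ _+_ (sym (Σ-*ˡ k (+ 4) _)) (trans (sym (Σ-neg k _)) (cong -_ (sym (Σ-*ˡ k (+ 2) _))))) ⟩
    c (suc k) + (+ 4 * moment k - + 2 * (c ⊛ c) k)
      ≡⟨ cong (λ t → c (suc k) + (t - + 2 * (c ⊛ c) k)) (trans (quadruple (moment k)) (cong (+ 2 *_) (moment-symmetry k))) ⟩
    c (suc k) + (+ 2 * ((+ 2 + + k) * (c ⊛ c) k) - + 2 * (c ⊛ c) k)
      ≡⟨ cong (λ t → c (suc k) + (t - + 2 * (c ⊛ c) k)) (sym (ZP.*-assoc (+ 2) (+ 2 + + k) ((c ⊛ c) k))) ⟩
    c (suc k) + (+ 2 * (+ 2 + + k) * (c ⊛ c) k - + 2 * (c ⊛ c) k) ∎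
    where
    open ≡-Reasoning
    unit : ∀ t → + 1 * (+ 1 * t) ≡ t
    unit = solve-∀
    quadruple : ∀ t → + 4 * t ≡ + 2 * (+ 2 * t)
    quadruple = solve-∀
    expand : ∀ j a b → (+ 2 + + 4 * j) * a * b ≡ + 4 * ((+ 1 + j) * (a * b)) - + 2 * (a * b)
    expand = solve-∀
    recur : ∀ j → + suc (suc j) * (c (suc j) * c (k ∸ j)) ≡ + 4 * (+ suc j * (c j * c (k ∸ j))) - + 2 * (c j * c (k ∸ j))
    recur j = trans (sym (ZP.*-assoc (+ suc (suc j)) (c (suc j)) (c (k ∸ j))))
                    (trans (cong (_* c (k ∸ j)) (catalan-recurrenceℤ j)) (expand (+ j) (c j) (c (k ∸ j))))

  -- Segner's recurrence C_{k+1} = Σ_{i ≤ k} C_i C_{k-i}, by induction: both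
  -- sides satisfy the same relation once multiplied by k+3.
  segner : ∀ k → c (suc k) ≡ (c ⊛ c) k
  segner zero    = refl
  segner (suc k) = ZP.*-cancelˡ-≡ (+ 3 + + k) _ _ (begin
    (+ 3 + + k) * c (suc (suc k))
      ≡⟨ catalan-recurrenceℤ (suc k) ⟩
    (+ 2 + + 4 * (+ 1 + + k)) * c (suc k)
      ≡⟨ regroup (c (suc k)) (+ k) ⟩
    + 2 * (c (suc k) + (+ 2 * (+ 2 + + k) * c (suc k) - + 2 * c (suc k)))
      ≡⟨ cong (λ s → + 2 * (c (suc k) + (+ 2 * (+ 2 + + k) * s - + 2 * s))) (segner k) ⟩
    + 2 * (c (suc k) + (+ 2 * (+ 2 + + k) * (c ⊛ c) k - + 2 * (c ⊛ c) k))
      ≡⟨ cong (+ 2 *_) (sym (moment-suc k)) ⟩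
    + 2 * moment (suc k)
      ≡⟨ moment-symmetry (suc k) ⟩
    (+ 3 + + k) * (c ⊛ c) (suc k) ∎)
    where
    open ≡-Reasoning
    regroup : ∀ c k → (+ 2 + + 4 * (+ 1 + k)) * c ≡ + 2 * (c + (+ 2 * (+ 2 + k) * c - + 2 * c))
    regroup = solve-∀

  catalan-equation : c ≈ oneS ⊕ X (c ⊛ c)
  catalan-equation zero    = refl
  catalan-equation (suc k) = trans (segner k) (sym (ZP.+-identityˡ _))

  -- The derivative of c: from c = 1 + x c² we get c' = c² + 2 x c c', i.e.
  -- c' (1 - 2 x c) = c², and multiplying by c (using (1 - 2xc) c = 2 - c)
  -- c' (2 - c) = c³.

  ∂c-equation : ∂ c ≈ c ⊛ c ⊕ X (+ 2 · (c ⊛ ∂ c))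
  ∂c-equation = begin
    ∂ c                                        ≈⟨ ∂-cong catalan-equation ⟩
    ∂ (oneS ⊕ X (c ⊛ c))                       ≈⟨ ∂-⊕ oneS (X (c ⊛ c)) ⟩
    ∂ oneS ⊕ ∂ (X (c ⊛ c))                     ≈⟨ ⊕-cong ∂-one (∂-X (c ⊛ c)) ⟩
    zeroS ⊕ (c ⊛ c ⊕ X (∂ (c ⊛ c)))            ≈⟨ (λ m → ZP.+-identityˡ _) ⟩
    c ⊛ c ⊕ X (∂ (c ⊛ c))                      ≈⟨ ⊕-cong (≈-refl {c ⊛ c}) (X-cong (∂-⊛ c c)) ⟩
    c ⊛ c ⊕ X (∂ c ⊛ c ⊕ c ⊛ ∂ c)              ≈⟨ ⊕-cong (≈-refl {c ⊛ c}) (X-cong (λ m → trans (cong (_+ (c ⊛ ∂ c) m) (⊛-comm (∂ c) c m)) (double ((c ⊛ ∂ c) m)))) ⟩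
    c ⊛ c ⊕ X (+ 2 · (c ⊛ ∂ c))                ∎
    where
    open ≈-Reasoning
    double : ∀ a → a + a ≡ + 2 * a
    double = solve-∀

  ∂c-times-[1-2xc] : ∂ c ⊛ (oneS ⊖ + 2 · X c) ≈ c ⊛ c
  ∂c-times-[1-2xc] m = begin
    (∂ c ⊛ (oneS ⊖ + 2 · X c)) m
      ≡⟨ ⊛-distribˡ-⊖ oneS (+ 2 · X c) (∂ c) m ⟩
    (∂ c ⊛ oneS) m - (∂ c ⊛ (+ 2 · X c)) m
      ≡⟨ cong₂ _-_ (⊛-one (∂ c) m) (trans (⊛-· (+ 2) (∂ c) (X c) m) (cong (+ 2 *_) (trans (⊛-X (∂ c) c m) (X-cong (⊛-comm (∂ c) c) m)))) ⟩
    ∂ c m - + 2 * X (c ⊛ ∂ c) m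
      ≡⟨ cong (_- + 2 * X (c ⊛ ∂ c) m) (trans (∂c-equation m) (cong (λ t → (c ⊛ c) m + t) (X-· (+ 2) (c ⊛ ∂ c) m))) ⟩
    (c ⊛ c) m + + 2 * X (c ⊛ ∂ c) m - + 2 * X (c ⊛ ∂ c) m
      ≡⟨ cancel ((c ⊛ c) m) (+ 2 * X (c ⊛ ∂ c) m) ⟩
    (c ⊛ c) m ∎
    where
    open ≡-Reasoning
    cancel : ∀ a b → a + b - b ≡ a
    cancel = solve-∀

  [1-2xc]-times-c : (oneS ⊖ + 2 · X c) ⊛ c ≈ + 2 · oneS ⊖ c
  [1-2xc]-times-c m = begin
    ((oneS ⊖ + 2 · X c) ⊛ c) m
      ≡⟨ ⊛-distribʳ-⊖ oneS (+ 2 · X c) c m ⟩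
    (oneS ⊛ c) m - ((+ 2 · X c) ⊛ c) m
      ≡⟨ cong₂ _-_ (one-⊛ c m) (trans (·-⊛ (+ 2) (X c) c m) (cong (+ 2 *_) (X-⊛ c c m))) ⟩
    c m - + 2 * X (c ⊛ c) m
      ≡⟨ cong (λ t → t - + 2 * X (c ⊛ c) m) (catalan-equation m) ⟩
    oneS m + X (c ⊛ c) m - + 2 * X (c ⊛ c) m
      ≡⟨ rearrange (oneS m) (X (c ⊛ c) m) ⟩
    + 2 * oneS m - (oneS m + X (c ⊛ c) m)
      ≡⟨ cong (λ t → + 2 * oneS m - t) (sym (catalan-equation m)) ⟩
    + 2 * oneS m - c m ∎
    where
    open ≡-Reasoning
    rearrange : ∀ a b → a + b - + 2 * b ≡ + 2 * a - (a + b)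
    rearrange = solve-∀

  ∂c-times-[2-c] : ∂ c ⊛ (+ 2 · oneS ⊖ c) ≈ c ⊛ (c ⊛ c)
  ∂c-times-[2-c] = begin
    ∂ c ⊛ (+ 2 · oneS ⊖ c)              ≈⟨ ⊛-congʳ (∂ c) (≈-sym [1-2xc]-times-c) ⟩
    ∂ c ⊛ ((oneS ⊖ + 2 · X c) ⊛ c)      ≈⟨ ≈-sym (⊛-assoc (∂ c) (oneS ⊖ + 2 · X c) c) ⟩
    ∂ c ⊛ (oneS ⊖ + 2 · X c) ⊛ c        ≈⟨ ⊛-congˡ c ∂c-times-[1-2xc] ⟩
    c ⊛ c ⊛ c                           ≈⟨ ⊛-comm (c ⊛ c) c ⟩
    c ⊛ (c ⊛ c)                         ∎
    where open ≈-Reasoning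

  -- twice n = 2n, by a recursion that unfolds along the rook recurrences below.
  twice : ℕ → ℕ
  twice zero    = zero
  twice (suc q) = suc (suc (twice q))

  twice-+ : ∀ a b → twice (a N.+ b) ≡ twice a N.+ twice b
  twice-+ zero    b = refl
  twice-+ (suc a) b = cong (λ t → suc (suc t)) (twice-+ a b)

  -- path L k: the number of ways to choose k pairwise non-adjacent edges in
  -- a path with L edges, i.e. k non-attacking rooks on a staircase of L cells.
  path : ℕ → ℕ → ℕ
  path L             zero    = 1
  path zero          (suc k) = 0
  path (suc zero)    (suc k) = 0
  path (suc (suc L)) (suc k) = path (suc L) (suc k) N.+ path L k

  -- multiset a k = (a+k-1 choose k): the coefficients of (1 + y)^(-a) up to sign.
  multiset : ℕ → ℕ → ℕ
  multiset zero    zero    = 1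
  multiset zero    (suc k) = 0
  multiset (suc a) zero    = 1
  multiset (suc a) (suc k) = multiset a (suc k) N.+ multiset (suc a) k

  multiset-zero : ∀ a → multiset a 0 ≡ 1
  multiset-zero zero    = refl
  multiset-zero (suc a) = refl

  multiset-one : ∀ k → multiset 1 k ≡ 1
  multiset-one zero    = refl
  multiset-one (suc k) = multiset-one k

  path-short : ∀ L k → L < twice k → path L k ≡ 0
  path-short zero          (suc k) _ = refl
  path-short (suc zero)    (suc k) _ = refl
  path-short (suc (suc L)) (suc k) (s≤s (s≤s L<2k)) =
    cong₂ N._+_ (path-short (suc L) (suc k) (NP.m≤n⇒m≤1+n (s≤s L<2k))) (path-short L k L<2k)

  path-multiset : ∀ k L → path (twice k N.+ L) k ≡ multiset (suc L) k
  path-multiset zero    L       = refl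
  path-multiset (suc k) zero    =
    cong₂ N._+_ (path-short (suc (twice k N.+ 0)) (suc k) (s≤s (s≤s (NP.≤-reflexive (NP.+-identityʳ (twice k))))))
                (path-multiset k zero)
  path-multiset (suc k) (suc L) =
    cong₂ N._+_ (trans (cong (λ t → path t (suc k)) (cong suc (NP.+-suc (twice k) L))) (path-multiset (suc k) L))
                (path-multiset k (suc L))

  path-diagonal : ∀ k → path (twice k) k ≡ 1
  path-diagonal k = trans (cong (λ t → path t k) (sym (NP.+-identityʳ (twice k))))
                          (trans (path-multiset k 0) (multiset-one k))

  sign : ℕ → ℤ
  sign k = -1ℤ ^ k

  -- Q a = Σ_k (-1)^k (a+k-1 choose k) xᵏ c^{2k}, the expansion of
  -- (1 + x c²)^{-a} = c^{-a}.
  Q : ℕ → Ser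
  Q a = SX (λ k → (sign k * + multiset a k) · (c ^ˢ twice k))

  previous : (ℕ → ℤ) → ℕ → ℤ
  previous s zero    = + 0
  previous s (suc k) = s k

  shift : (ℕ → Ser) → ℕ → Ser
  shift F zero    = zeroS
  shift F (suc n) = F n

  X-SX : ∀ F → X (SX F) ≈ SX (shift F)
  X-SX F zero    = refl
  X-SX F (suc m) = sym (trans (Σ-head m _) (ZP.+-identityˡ _))

  -- Since c = 1 + x c², multiplying Σ s_k xᵏ c^{2k} by c adds s_{k-1} to s_k.
  c-times-SX : ∀ (s : ℕ → ℤ) →
    c ⊛ SX (λ k → s k · (c ^ˢ twice k)) ≈ SX (λ k → (s k + previous s k) · (c ^ˢ twice k))
  c-times-SX s = begin
    c ⊛ SX G                               ≈⟨ ⊛-congˡ (SX G) catalan-equation ⟩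
    (oneS ⊕ X (c ⊛ c)) ⊛ SX G              ≈⟨ ⊛-distribʳ oneS (X (c ⊛ c)) (SX G) ⟩
    oneS ⊛ SX G ⊕ X (c ⊛ c) ⊛ SX G         ≈⟨ ⊕-cong (one-⊛ (SX G)) (X-⊛ (c ⊛ c) (SX G)) ⟩
    SX G ⊕ X ((c ⊛ c) ⊛ SX G)              ≈⟨ ⊕-cong (≈-refl {SX G}) (X-cong (⊛-comm (c ⊛ c) (SX G))) ⟩
    SX G ⊕ X (SX G ⊛ (c ⊛ c))              ≈⟨ ⊕-cong (≈-refl {SX G}) (X-cong (SX-⊛ G (c ⊛ c))) ⟩
    SX G ⊕ X (SX (λ k → G k ⊛ (c ⊛ c)))    ≈⟨ ⊕-cong (≈-refl {SX G}) (X-SX (λ k → G k ⊛ (c ⊛ c))) ⟩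
    SX G ⊕ SX (shift (λ k → G k ⊛ (c ⊛ c)))  ≈⟨ ≈-sym (SX-⊕ G (shift (λ k → G k ⊛ (c ⊛ c)))) ⟩
    SX (λ k → G k ⊕ shift (λ k → G k ⊛ (c ⊛ c)) k)  ≈⟨ SX-cong combine ⟩
    SX (λ k → (s k + previous s k) · (c ^ˢ twice k)) ∎
    where
    open ≈-Reasoning
    G : ℕ → Ser
    G k = s k · (c ^ˢ twice k)
    raise : ∀ j → G j ⊛ (c ⊛ c) ≈ s j · (c ^ˢ twice (suc j))
    raise j m = trans (·-⊛ (s j) (c ^ˢ twice j) (c ⊛ c) m)
                      (cong (s j *_) (trans (⊛-comm (c ^ˢ twice j) (c ⊛ c) m) (⊛-assoc c c (c ^ˢ twice j) m)))
    combine : ∀ k → G k ⊕ shift (λ k → G k ⊛ (c ⊛ c)) k ≈ (s k + previous s k) · (c ^ˢ twice k)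
    combine zero    m = trans (ZP.+-identityʳ _) (cong (_* (c ^ˢ 0) m) (sym (ZP.+-identityʳ (s 0))))
    combine (suc j) m = trans (cong (λ t → s (suc j) * (c ^ˢ twice (suc j)) m + t) (raise j m))
                              (sym (ZP.*-distribʳ-+ ((c ^ˢ twice (suc j)) m) (s (suc j)) (s j)))

  -- c · Q (a+1) = Q a, by Pascal's rule for the multiset numbers.
  c-times-Q : ∀ a → c ⊛ Q (suc a) ≈ Q a
  c-times-Q a = ≈-trans (c-times-SX (λ k → sign k * + multiset (suc a) k))
                        (SX-cong (λ k m → cong (_* (c ^ˢ twice k) m) (pascal k)))
    where
    pascal : ∀ k → sign k * + multiset (suc a) k + previous (λ k → sign k * + multiset (suc a) k) k ≡ sign k * + multiset a k
    pascal zero    = cong (λ t → + 1 * + t) (sym (multiset-zero a))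
    pascal (suc k) = begin
      sign (suc k) * + (multiset a (suc k) N.+ multiset (suc a) k) + sign k * + multiset (suc a) k
        ≡⟨ cong₂ (λ x y → x * y + sign k * + multiset (suc a) k) (ZP.-1*i≡-i (sign k)) (ZP.pos-+ (multiset a (suc k)) (multiset (suc a) k)) ⟩
      - sign k * (+ multiset a (suc k) + + multiset (suc a) k) + sign k * + multiset (suc a) k
        ≡⟨ cancel (sign k) (+ multiset a (suc k)) (+ multiset (suc a) k) ⟩
      - sign k * + multiset a (suc k)
        ≡⟨ cong (_* + multiset a (suc k)) (sym (ZP.-1*i≡-i (sign k))) ⟩
      sign (suc k) * + multiset a (suc k) ∎
      where
      open ≡-Reasoning
      cancel : ∀ g x y → - g * (x + y) + g * y ≡ - g * x
      cancel = solve-∀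

  Q-zero : Q 0 ≈ oneS
  Q-zero m = trans (SX-single (λ k → (sign k * + multiset 0 k) · (c ^ˢ twice k)) vanish m) (ZP.*-identityˡ (oneS m))
    where
    vanish : ∀ n → (sign (suc n) * + 0) · (c ^ˢ twice (suc n)) ≈ zeroS
    vanish n m = trans (cong (_* (c ^ˢ twice (suc n)) m) (ZP.*-zeroʳ (sign (suc n)))) (ZP.*-zeroˡ ((c ^ˢ twice (suc n)) m))

  c^a-times-Q : ∀ a → c ^ˢ a ⊛ Q a ≈ oneS
  c^a-times-Q zero    = ≈-trans (one-⊛ (Q 0)) Q-zero
  c^a-times-Q (suc a) = begin
    c ⊛ c ^ˢ a ⊛ Q (suc a)         ≈⟨ ⊛-assoc c (c ^ˢ a) (Q (suc a)) ⟩
    c ⊛ (c ^ˢ a ⊛ Q (suc a))       ≈⟨ ⊛-lcomm c (c ^ˢ a) (Q (suc a)) ⟩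
    c ^ˢ a ⊛ (c ⊛ Q (suc a))       ≈⟨ ⊛-congʳ (c ^ˢ a) (c-times-Q a) ⟩
    c ^ˢ a ⊛ Q a                   ≈⟨ c^a-times-Q a ⟩
    oneS                           ∎
    where open ≈-Reasoning

  sumOver : (List ℕ → ℤ) → List (List ℕ) → ℤ
  sumOver f []       = + 0
  sumOver f (σ ∷ σs) = f σ + sumOver f σs

  sumOver-++ : ∀ f σs τs → sumOver f (σs ++ τs) ≡ sumOver f σs + sumOver f τs
  sumOver-++ f []       τs = sym (ZP.+-identityˡ _)
  sumOver-++ f (σ ∷ σs) τs rewrite sumOver-++ f σs τs = sym (ZP.+-assoc (f σ) (sumOver f σs) (sumOver f τs))

  sumOver-map : ∀ f g σs → sumOver f (map g σs) ≡ sumOver (f ∘ g) σs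
  sumOver-map f g []       = refl
  sumOver-map f g (σ ∷ σs) = cong (λ t → f (g σ) + t) (sumOver-map f g σs)

  sumOver-concatMap : ∀ f (g : List ℕ → List (List ℕ)) σs →
    sumOver f (concatMap g σs) ≡ sumOver (λ σ → sumOver f (g σ)) σs
  sumOver-concatMap f g []       = refl
  sumOver-concatMap f g (σ ∷ σs) =
    trans (sumOver-++ f (g σ) (concatMap g σs)) (cong (λ t → sumOver f (g σ) + t) (sumOver-concatMap f g σs))

  sumOver-cong : ∀ {f g} σs → (∀ σ → f σ ≡ g σ) → sumOver f σs ≡ sumOver g σs
  sumOver-cong []       h = refl
  sumOver-cong (σ ∷ σs) h = cong₂ _+_ (h σ) (sumOver-cong σs h)

  sumOver-+ : ∀ f g σs → sumOver (λ σ → f σ + g σ) σs ≡ sumOver f σs + sumOver g σs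
  sumOver-+ f g []       = refl
  sumOver-+ f g (σ ∷ σs) rewrite sumOver-+ f g σs = interchange (f σ) (g σ) (sumOver f σs) (sumOver g σs)
    where
    interchange : ∀ a b c d → a + b + (c + d) ≡ a + c + (b + d)
    interchange = solve-∀

  sumOver-*ˡ : ∀ a f σs → a * sumOver f σs ≡ sumOver (λ σ → a * f σ) σs
  sumOver-*ˡ a f []       = ZP.*-zeroʳ a
  sumOver-*ˡ a f (σ ∷ σs) = trans (ZP.*-distribˡ-+ a (f σ) (sumOver f σs)) (cong (λ t → a * f σ + t) (sumOver-*ˡ a f σs))

  -- pickSum L F = Σ F y r over the ways of picking one entry y of L, r being
  -- L with that entry removed.
  pickSum : List ℕ → (ℕ → List ℕ → ℤ) → ℤ
  pickSum []       F = + 0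
  pickSum (x ∷ xs) F = F x xs + pickSum xs (λ y r → F y (x ∷ r))

  pickSum-cong : ∀ L {F G : ℕ → List ℕ → ℤ} → (∀ y r → F y r ≡ G y r) → pickSum L F ≡ pickSum L G
  pickSum-cong []       h = refl
  pickSum-cong (x ∷ xs) h = cong₂ _+_ (h x xs) (pickSum-cong xs (λ y r → h y (x ∷ r)))

  pickSum-cong-length : ∀ L n {F G : ℕ → List ℕ → ℤ} → length L ≡ suc n →
    (∀ y r → length r ≡ n → F y r ≡ G y r) → pickSum L F ≡ pickSum L G
  pickSum-cong-length (x ∷ [])      n       e h = cong₂ _+_ (h x [] (NP.suc-injective e)) refl
  pickSum-cong-length (x ∷ x′ ∷ xs) (suc n) e h =
    cong₂ _+_ (h x (x′ ∷ xs) (NP.suc-injective e))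
              (pickSum-cong-length (x′ ∷ xs) n (NP.suc-injective e) (λ y r e′ → h y (x ∷ r) (cong suc e′)))

  pickSum-cong-All : ∀ {P : ℕ → Set} L {F G : ℕ → List ℕ → ℤ} → All P L →
    (∀ y r → P y → All P r → F y r ≡ G y r) → pickSum L F ≡ pickSum L G
  pickSum-cong-All []       _          h = refl
  pickSum-cong-All (x ∷ xs) (px ∷ pxs) h =
    cong₂ _+_ (h x xs px pxs) (pickSum-cong-All xs pxs (λ y r py pr → h y (x ∷ r) py (px ∷ pr)))

  pickSum-+ : ∀ L F G → pickSum L (λ y r → F y r + G y r) ≡ pickSum L F + pickSum L G
  pickSum-+ []       F G = refl
  pickSum-+ (x ∷ xs) F G rewrite pickSum-+ xs (λ y r → F y (x ∷ r)) (λ y r → G y (x ∷ r)) =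
    interchange (F x xs) (G x xs) _ _
    where
    interchange : ∀ a b c d → a + b + (c + d) ≡ a + c + (b + d)
    interchange = solve-∀

  pickSum-*ˡ : ∀ L a F → a * pickSum L F ≡ pickSum L (λ y r → a * F y r)
  pickSum-*ˡ []       a F = ZP.*-zeroʳ a
  pickSum-*ˡ (x ∷ xs) a F =
    trans (ZP.*-distribˡ-+ a (F x xs) _) (cong (λ t → a * F x xs + t) (pickSum-*ˡ xs a (λ y r → F y (x ∷ r))))

  pickSum-*ʳ : ∀ L a F → pickSum L F * a ≡ pickSum L (λ y r → F y r * a)
  pickSum-*ʳ L a F = trans (ZP.*-comm (pickSum L F) a) (trans (pickSum-*ˡ L a F) (pickSum-cong L (λ y r → ZP.*-comm a (F y r))))

  pickSum-zero : ∀ L → pickSum L (λ _ _ → + 0) ≡ + 0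
  pickSum-zero []       = refl
  pickSum-zero (x ∷ xs) = trans (ZP.+-identityˡ _) (pickSum-zero xs)

  pickSum-one : ∀ L → pickSum L (λ _ _ → + 1) ≡ + length L
  pickSum-one []       = refl
  pickSum-one (x ∷ xs) = cong (λ t → + 1 + t) (pickSum-one xs)

  pickSum-Σ : ∀ L q (G : ℕ → List ℕ → ℕ → ℤ) → pickSum L (λ y r → Σ q (G y r)) ≡ Σ q (λ k → pickSum L (λ y r → G y r k))
  pickSum-Σ L zero    G = refl
  pickSum-Σ L (suc q) G = trans (pickSum-+ L _ _) (cong (_+ pickSum L (λ y r → G y r (suc q))) (pickSum-Σ L q G))

  pickSum-swap : ∀ L (F : ℕ → ℕ → List ℕ → ℤ) →
    pickSum L (λ y r → pickSum r (λ y′ r′ → F y y′ r′)) ≡ pickSum L (λ y′ r → pickSum r (λ y r′ → F y y′ r′))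
  pickSum-swap []       F = refl
  pickSum-swap (x ∷ xs) F = begin
    pickSum xs (F x) + pickSum xs (λ y r → F y x r + later y r)
      ≡⟨ cong (λ t → pickSum xs (F x) + t) (pickSum-+ xs (λ y r → F y x r) later) ⟩
    pickSum xs (F x) + (pickSum xs (λ y r → F y x r) + pickSum xs later)
      ≡⟨ cong (λ t → pickSum xs (F x) + (pickSum xs (λ y r → F y x r) + t)) (pickSum-swap xs (λ y y′ r′ → F y y′ (x ∷ r′))) ⟩
    pickSum xs (F x) + (pickSum xs (λ y r → F y x r) + pickSum xs later′)
      ≡⟨ exchange (pickSum xs (F x)) (pickSum xs (λ y r → F y x r)) (pickSum xs later′) ⟩
    pickSum xs (λ y r → F y x r) + (pickSum xs (F x) + pickSum xs later′)
      ≡⟨ cong (λ t → pickSum xs (λ y r → F y x r) + t) (sym (pickSum-+ xs (F x) later′)) ⟩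
    pickSum xs (λ y r → F y x r) + pickSum xs (λ y′ r → F x y′ r + later′ y′ r) ∎
    where
    open ≡-Reasoning
    later later′ : ℕ → List ℕ → ℤ
    later  y  r = pickSum r (λ y′ r′ → F y y′ (x ∷ r′))
    later′ y′ r = pickSum r (λ y r′ → F y y′ (x ∷ r′))
    exchange : ∀ a b c → a + (b + c) ≡ b + (a + c)
    exchange = solve-∀

  pickSum-++ : ∀ A B F → pickSum (A ++ B) F ≡ pickSum A (λ y r → F y (r ++ B)) + pickSum B (λ y r → F y (A ++ r))
  pickSum-++ []      B F = sym (ZP.+-identityˡ _)
  pickSum-++ (x ∷ A) B F = trans (cong (λ t → F x (A ++ B) + t) (pickSum-++ A B (λ y r → F y (x ∷ r))))
                                 (sym (ZP.+-assoc (F x (A ++ B)) _ _))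

  first-entry : ∀ x xs f → sumOver f (perms (x ∷ xs)) ≡ pickSum (x ∷ xs) (λ y r → sumOver (λ σ → f (y ∷ σ)) (perms r))
  first-entry x []        f = unit (f (x ∷ []))
    where
    unit : ∀ a → a + + 0 ≡ a + + 0 + + 0
    unit = solve-∀
  first-entry x (x′ ∷ xs) f = begin
    sumOver f (concatMap (insertions x) (perms (x′ ∷ xs)))
      ≡⟨ sumOver-concatMap f (insertions x) (perms (x′ ∷ xs)) ⟩
    sumOver g (perms (x′ ∷ xs))
      ≡⟨ first-entry x′ xs g ⟩
    pickSum (x′ ∷ xs) (λ y r → sumOver (λ σ → g (y ∷ σ)) (perms r))
      ≡⟨ pickSum-cong (x′ ∷ xs) insert-behind ⟩
    pickSum (x′ ∷ xs) (λ y r → sumOver (λ σ → f (x ∷ y ∷ σ)) (perms r) + sumOver (λ σ → f (y ∷ σ)) (perms (x ∷ r)))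
      ≡⟨ pickSum-+ (x′ ∷ xs) (λ y r → sumOver (λ σ → f (x ∷ y ∷ σ)) (perms r)) (λ y r → sumOver (λ σ → f (y ∷ σ)) (perms (x ∷ r))) ⟩
    pickSum (x′ ∷ xs) (λ y r → sumOver (λ σ → f (x ∷ y ∷ σ)) (perms r)) + pickSum (x′ ∷ xs) (λ y r → sumOver (λ σ → f (y ∷ σ)) (perms (x ∷ r)))
      ≡⟨ cong (_+ pickSum (x′ ∷ xs) (λ y r → sumOver (λ σ → f (y ∷ σ)) (perms (x ∷ r)))) (sym (first-entry x′ xs (λ τ → f (x ∷ τ)))) ⟩
    sumOver (λ τ → f (x ∷ τ)) (perms (x′ ∷ xs)) + pickSum (x′ ∷ xs) (λ y r → sumOver (λ σ → f (y ∷ σ)) (perms (x ∷ r))) ∎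
    where
    open ≡-Reasoning
    -- inserting x into a permutation: in front of it, or somewhere behind its head
    g : List ℕ → ℤ
    g σ = sumOver f (insertions x σ)
    insert-behind : ∀ y r → sumOver (λ σ → g (y ∷ σ)) (perms r)
                          ≡ sumOver (λ σ → f (x ∷ y ∷ σ)) (perms r) + sumOver (λ σ → f (y ∷ σ)) (perms (x ∷ r))
    insert-behind y r = trans (sumOver-cong (perms r) (λ σ → cong (λ t → f (x ∷ y ∷ σ) + t) (sumOver-map f (y ∷_) (insertions x σ))))
                        (trans (sumOver-+ _ _ (perms r))
                        (cong (λ t → sumOver (λ σ → f (x ∷ y ∷ σ)) (perms r) + t) (sym (sumOver-concatMap (λ σ → f (y ∷ σ)) (insertions x) (perms r)))))

  sumOver-perms-cong : ∀ n L → length L ≡ n → ∀ f g → (∀ σ → length σ ≡ n → f σ ≡ g σ) → sumOver f (perms L) ≡ sumOver g (perms L)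
  sumOver-perms-cong zero    []       e f g h = cong (_+ + 0) (h [] refl)
  sumOver-perms-cong (suc n) (x ∷ xs) e f g h =
    trans (first-entry x xs f)
   (trans (pickSum-cong-length (x ∷ xs) n e (λ y r e′ → sumOver-perms-cong n r e′ (λ σ → f (y ∷ σ)) (λ σ → g (y ∷ σ)) (λ σ e″ → h (y ∷ σ) (cong suc e″))))
          (sym (first-entry x xs g)))

  range : ℕ → ℕ → List ℕ
  range p zero    = []
  range p (suc q) = p ∷ range (suc p) q

  length-range : ∀ p q → length (range p q) ≡ q
  length-range p zero    = refl
  length-range p (suc q) = cong suc (length-range (suc p) q)

  all-range : ∀ a q → All (λ y → a ≤ y × y < a N.+ q) (range a q)
  all-range a zero    = []
  all-range a (suc q) = (NP.≤-refl , NP.m<m+n a (s≤s z≤n)) ∷ weaken (all-range (suc a) q)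
    where
    weaken : ∀ {L} → All (λ y → suc a ≤ y × y < suc a N.+ q) L → All (λ y → a ≤ y × y < a N.+ suc q) L
    weaken []                       = []
    weaken {x ∷ _} ((a<x , x<) ∷ xs) = (NP.<⇒≤ a<x , subst (x <_) (sym (NP.+-suc a q)) x<) ∷ weaken xs

  ind : Bool → ℤ
  ind true  = + 1
  ind false = + 0

  -- A board is a relation forbidden p y between positions and values.
  -- rooks q rest p k counts the placements of k non-attacking rooks on its
  -- cells with position in p, …, p+q-1 and value in rest: position p is
  -- either left empty, or gets a rook on a forbidden value y of rest.
  module Rooks (forbidden : ℕ → ℕ → Bool) where

    rooks : ℕ → List ℕ → ℕ → ℕ → ℤ
    rooks zero    rest p zero    = + 1
    rooks zero    rest p (suc k) = + 0
    rooks (suc q) rest p zero    = rooks q rest (suc p) zero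
    rooks (suc q) rest p (suc k) = rooks q rest (suc p) (suc k) + pickSum rest (λ y r → ind (forbidden p y) * rooks q r (suc p) k)

    rooks-none : ∀ q rest p → rooks q rest p 0 ≡ + 1
    rooks-none zero    rest p = refl
    rooks-none (suc q) rest p = rooks-none q rest (suc p)

    -- At most one rook per position.
    rooks-too-many : ∀ q rest p k → q < k → rooks q rest p k ≡ + 0
    rooks-too-many zero    rest p (suc k) _         = refl
    rooks-too-many (suc q) rest p (suc k) (s≤s q<k) =
      cong₂ _+_ (rooks-too-many q rest (suc p) (suc k) (NP.m≤n⇒m≤1+n q<k))
                (trans (pickSum-cong rest (λ y r → trans (cong (ind (forbidden p y) *_) (rooks-too-many q r (suc p) k q<k)) (ZP.*-zeroʳ (ind (forbidden p y)))))
                       (pickSum-zero rest))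

    -- Double counting pairs (placement, unused value): removing a value y
    -- and summing over y counts each placement once per value it avoids.
    rooks-removal : ∀ q rest p k → pickSum rest (λ y r → rooks q r p k) ≡ + (length rest ∸ k) * rooks q rest p k
    rooks-removal zero    rest p zero    = trans (pickSum-one rest) (sym (ZP.*-identityʳ _))
    rooks-removal zero    rest p (suc k) = trans (pickSum-zero rest) (sym (ZP.*-zeroʳ (+ (length rest ∸ suc k))))
    rooks-removal (suc q) rest p zero    =
      trans (pickSum-cong rest (λ y r → rooks-none q r (suc p)))
     (trans (pickSum-one rest) (sym (trans (cong (+ length rest *_) (rooks-none q rest (suc p))) (ZP.*-identityʳ _))))
    rooks-removal (suc q) []       p (suc k) = refl
    rooks-removal (suc q) (x ∷ xs) p (suc k) = begin
      pickSum rest (λ y r → rooks q r (suc p) (suc k) + pickSum r (λ y′ r′ → placed y′ r′))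
        ≡⟨ pickSum-+ rest (λ y r → rooks q r (suc p) (suc k)) (λ y r → pickSum r placed) ⟩
      pickSum rest (λ y r → rooks q r (suc p) (suc k)) + pickSum rest (λ y r → pickSum r placed)
        ≡⟨ cong₂ _+_ (rooks-removal q rest (suc p) (suc k)) (pickSum-swap rest (λ y y′ r′ → placed y′ r′)) ⟩
      + (n ∸ k) * rooks q rest (suc p) (suc k) + pickSum rest (λ y′ r → pickSum r (λ y r′ → placed y′ r′))
        ≡⟨ cong (λ t → + (n ∸ k) * rooks q rest (suc p) (suc k) + t) (pickSum-cong-length rest n refl removal-after) ⟩
      + (n ∸ k) * rooks q rest (suc p) (suc k) + pickSum rest (λ y′ r → + (n ∸ k) * placed y′ r)
        ≡⟨ cong (λ t → + (n ∸ k) * rooks q rest (suc p) (suc k) + t) (sym (pickSum-*ˡ rest (+ (n ∸ k)) placed)) ⟩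
      + (n ∸ k) * rooks q rest (suc p) (suc k) + + (n ∸ k) * pickSum rest placed
        ≡⟨ sym (ZP.*-distribˡ-+ (+ (n ∸ k)) _ _) ⟩
      + (n ∸ k) * rooks (suc q) rest p (suc k) ∎
      where
      open ≡-Reasoning
      rest = x ∷ xs
      n = length xs
      placed : ℕ → List ℕ → ℤ
      placed y r = ind (forbidden p y) * rooks q r (suc p) k
      exchange : ∀ a b c → a * (b * c) ≡ b * (a * c)
      exchange = solve-∀
      removal-after : ∀ y′ r → length r ≡ n → pickSum r (λ y r′ → placed y′ r′) ≡ + (n ∸ k) * placed y′ r
      removal-after y′ r e = begin
        pickSum r (λ y r′ → ind (forbidden p y′) * rooks q r′ (suc p) k)
          ≡⟨ sym (pickSum-*ˡ r (ind (forbidden p y′)) _) ⟩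
        ind (forbidden p y′) * pickSum r (λ y r′ → rooks q r′ (suc p) k)
          ≡⟨ cong (ind (forbidden p y′) *_) (rooks-removal q r (suc p) k) ⟩
        ind (forbidden p y′) * (+ (length r ∸ k) * rooks q r (suc p) k)
          ≡⟨ cong (λ m → ind (forbidden p y′) * (+ (m ∸ k) * rooks q r (suc p) k)) e ⟩
        ind (forbidden p y′) * (+ (n ∸ k) * rooks q r (suc p) k)
          ≡⟨ exchange (ind (forbidden p y′)) (+ (n ∸ k)) _ ⟩
        + (n ∸ k) * placed y′ r ∎

    rooks-unused : ∀ d q p k A S → (∀ i → p ≤ i → forbidden i d ≡ false) → rooks q (A ++ d ∷ S) p k ≡ rooks q (A ++ S) p k
    rooks-unused d zero    p zero    A S free = refl
    rooks-unused d zero    p (suc k) A S free = refl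
    rooks-unused d (suc q) p zero    A S free = rooks-unused d q (suc p) zero A S (λ i le → free i (NP.<⇒≤ le))
    rooks-unused d (suc q) p (suc k) A S free = cong₂ _+_ (rooks-unused d q (suc p) (suc k) A S free′) (begin
      pickSum (A ++ d ∷ S) F
        ≡⟨ pickSum-++ A (d ∷ S) F ⟩
      pickSum A (λ y r → F y (r ++ d ∷ S)) + (F d (A ++ S) + pickSum S (λ y r → F y (A ++ d ∷ r)))
        ≡⟨ cong₂ _+_ (pickSum-cong A (λ y r → cong (ind (forbidden p y) *_) (rooks-unused d q (suc p) k r S free′)))
                     (cong₂ _+_ d-excluded (pickSum-cong S (λ y r → cong (ind (forbidden p y) *_) (rooks-unused d q (suc p) k A r free′)))) ⟩
      pickSum A (λ y r → F y (r ++ S)) + (+ 0 + pickSum S (λ y r → F y (A ++ r)))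
        ≡⟨ cong (λ t → pickSum A (λ y r → F y (r ++ S)) + t) (ZP.+-identityˡ _) ⟩
      pickSum A (λ y r → F y (r ++ S)) + pickSum S (λ y r → F y (A ++ r))
        ≡⟨ sym (pickSum-++ A S F) ⟩
      pickSum (A ++ S) F ∎)
      where
      open ≡-Reasoning
      free′ : ∀ i → suc p ≤ i → forbidden i d ≡ false
      free′ i le = free i (NP.<⇒≤ le)
      F : ℕ → List ℕ → ℤ
      F y r = ind (forbidden p y) * rooks q r (suc p) k
      d-excluded : F d (A ++ S) ≡ + 0
      d-excluded = trans (cong (λ b → ind b * rooks q (A ++ S) (suc p) k) (free p NP.≤-refl)) (ZP.*-zeroˡ (rooks q (A ++ S) (suc p) k))

    row-avoids-range : ∀ p a q (G : ℕ → List ℕ → ℤ) → (∀ j → forbidden p (a N.+ j) ≡ false) →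
      pickSum (range a q) (λ y r → ind (forbidden p y) * G y r) ≡ + 0
    row-avoids-range p a zero    G avoid = refl
    row-avoids-range p a (suc q) G avoid = cong₂ _+_
      (trans (cong (λ b → ind b * G a (range (suc a) q)) (trans (cong (forbidden p) (sym (NP.+-identityʳ a))) (avoid 0)))
             (ZP.*-zeroˡ (G a (range (suc a) q))))
      (row-avoids-range p (suc a) q (λ y r → G y (a ∷ r)) (λ j → trans (cong (forbidden p) (sym (NP.+-suc a j))) (avoid (suc j))))

  rooks-cong : ∀ (h₁ h₂ : ℕ → ℕ → Bool) (Good : ℕ → Set) q rest p k → All Good rest →
    (∀ i y → p ≤ i → Good y → h₁ i y ≡ h₂ i y) → Rooks.rooks h₁ q rest p k ≡ Rooks.rooks h₂ q rest p k
  rooks-cong h₁ h₂ Good zero    rest p zero    good agree = refl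
  rooks-cong h₁ h₂ Good zero    rest p (suc k) good agree = refl
  rooks-cong h₁ h₂ Good (suc q) rest p zero    good agree =
    rooks-cong h₁ h₂ Good q rest (suc p) zero good (λ i y le gy → agree i y (NP.<⇒≤ le) gy)
  rooks-cong h₁ h₂ Good (suc q) rest p (suc k) good agree = cong₂ _+_
    (rooks-cong h₁ h₂ Good q rest (suc p) (suc k) good agree′)
    (pickSum-cong-All rest good (λ y r gy gr → cong₂ _*_ (cong ind (agree p y NP.≤-refl gy)) (rooks-cong h₁ h₂ Good q r (suc p) k gr agree′)))
    where
    agree′ : ∀ i y → suc p ≤ i → Good y → h₁ i y ≡ h₂ i y
    agree′ i y le gy = agree i y (NP.<⇒≤ le) gy

  -- The rook expansion: for a board h and any z, the weight
  -- ∏ᵢ (1 + z [h(i, πᵢ)]) summed over all permutations π of n values is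
  -- Σ_k zᵏ r_k (n-k)!, r_k being the rook numbers of h.
  module RookExpansion (forbidden : ℕ → ℕ → Bool) (z : ℤ) where

    open Rooks forbidden

    weight : ℕ → ℕ → ℤ
    weight p y = + 1 + z * ind (forbidden p y)

    wordWeight : ℕ → List ℕ → ℤ
    wordWeight p []      = + 1
    wordWeight p (y ∷ σ) = weight p y * wordWeight (suc p) σ

    -- The total weight of the q-letter words without repetition from rest.
    partialWeight : ℕ → List ℕ → ℕ → ℤ
    partialWeight zero    rest p = + 1
    partialWeight (suc q) rest p = pickSum rest (λ y r → weight p y * partialWeight q r (suc p))

    permutation-weights : ∀ n rest p → length rest ≡ n → sumOver (wordWeight p) (perms rest) ≡ partialWeight n rest p
    permutation-weights zero    []       p e = refl
    permutation-weights (suc n) (x ∷ xs) p e = trans (first-entry x xs (wordWeight p)) (pickSum-cong-length (x ∷ xs) n e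
      (λ y r e′ → trans (sym (sumOver-*ˡ (weight p y) (wordWeight (suc p)) (perms r))) (cong (weight p y *_) (permutation-weights n r (suc p) e′))))

    -- Words of length q from a list of n values, completed by the (n-q)!
    -- arrangements of the remaining values: expanding each weight 1 + z[h]
    -- and grouping by the set of forbidden cells used.
    rook-expansion : ∀ q rest p → q ≤ length rest →
      partialWeight q rest p * + ((length rest ∸ q) !) ≡ Σ q (λ k → z ^ k * rooks q rest p k * + ((length rest ∸ k) !))
    rook-expansion zero    rest     p _         = refl
    rook-expansion (suc q) (x ∷ xs) p (s≤s q≤n) = begin
      pickSum rest (λ y r → weight p y * partialWeight q r (suc p)) * + ((n ∸ q) !)
        ≡⟨ pickSum-*ʳ rest (+ ((n ∸ q) !)) (λ y r → weight p y * partialWeight q r (suc p)) ⟩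
      pickSum rest (λ y r → weight p y * partialWeight q r (suc p) * + ((n ∸ q) !))
        ≡⟨ pickSum-cong-length rest n refl first-position ⟩
      pickSum rest (λ y r → Σ q (λ k → F k y r))
        ≡⟨ pickSum-Σ rest q (λ y r k → F k y r) ⟩
      Σ q (λ k → pickSum rest (F k))
        ≡⟨ Σ-cong q (λ k → pickSum-+ rest (λ y r → z ^ k * fact k * rooks q r (suc p) k) (λ y r → z ^ suc k * fact k * placed k y r)) ⟩
      Σ q (λ k → pickSum rest (λ y r → z ^ k * fact k * rooks q r (suc p) k) + pickSum rest (λ y r → z ^ suc k * fact k * placed k y r))
        ≡⟨ Σ-cong-≤ q (λ k k≤q → cong₂ _+_ (free-position k k≤q) (sym (pickSum-*ˡ rest (z ^ suc k * fact k) (placed k)))) ⟩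
      Σ q (λ k → z ^ k * R k * + ((suc n ∸ k) !) + z ^ suc k * fact k * σ k)
        ≡⟨ Σ-+ q _ _ ⟩
      Σ q (λ k → z ^ k * R k * + ((suc n ∸ k) !)) + Σ q (λ k → z ^ suc k * fact k * σ k)
        ≡⟨ cong (_+ Σ q (λ k → z ^ suc k * fact k * σ k)) shift-index ⟩
      z ^ 0 * rooks (suc q) rest p 0 * + ((suc n) !) + Σ q (λ k → z ^ suc k * R (suc k) * fact k) + Σ q (λ k → z ^ suc k * fact k * σ k)
        ≡⟨ ZP.+-assoc (z ^ 0 * rooks (suc q) rest p 0 * + ((suc n) !)) _ _ ⟩
      z ^ 0 * rooks (suc q) rest p 0 * + ((suc n) !) + (Σ q (λ k → z ^ suc k * R (suc k) * fact k) + Σ q (λ k → z ^ suc k * fact k * σ k))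
        ≡⟨ cong (λ t → z ^ 0 * rooks (suc q) rest p 0 * + ((suc n) !) + t) (trans (sym (Σ-+ q _ _)) (Σ-cong q recombine)) ⟩
      z ^ 0 * rooks (suc q) rest p 0 * + ((suc n) !) + Σ q (λ k → z ^ suc k * rooks (suc q) rest p (suc k) * fact k)
        ≡⟨ sym (Σ-head q (λ k → z ^ k * rooks (suc q) rest p k * + ((suc n ∸ k) !))) ⟩
      Σ (suc q) (λ k → z ^ k * rooks (suc q) rest p k * + ((suc n ∸ k) !)) ∎
      where
      open ≡-Reasoning
      rest = x ∷ xs
      n = length xs
      fact : ℕ → ℤ
      fact k = + ((n ∸ k) !)
      R : ℕ → ℤ
      R k = rooks q rest (suc p) k
      placed : ℕ → ℕ → List ℕ → ℤ
      placed k y r = ind (forbidden p y) * rooks q r (suc p) k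
      σ : ℕ → ℤ
      σ k = pickSum rest (placed k)
      F : ℕ → ℕ → List ℕ → ℤ
      F k y r = z ^ k * fact k * rooks q r (suc p) k + z ^ suc k * fact k * placed k y r
      first-position : ∀ y r → length r ≡ n → weight p y * partialWeight q r (suc p) * fact q ≡ Σ q (λ k → F k y r)
      first-position y r e = begin
        weight p y * partialWeight q r (suc p) * fact q          ≡⟨ ZP.*-assoc (weight p y) _ _ ⟩
        weight p y * (partialWeight q r (suc p) * fact q)        ≡⟨ cong (weight p y *_) (induction r e) ⟩
        weight p y * Σ q (λ k → z ^ k * rooks q r (suc p) k * fact k)  ≡⟨ Σ-*ˡ q (weight p y) _ ⟩
        Σ q (λ k → weight p y * (z ^ k * rooks q r (suc p) k * fact k)) ≡⟨ Σ-cong q (λ k → expand z (ind (forbidden p y)) (z ^ k) (rooks q r (suc p) k) (fact k)) ⟩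
        Σ q (λ k → F k y r) ∎
        where
        induction : ∀ r → length r ≡ n → partialWeight q r (suc p) * fact q ≡ Σ q (λ k → z ^ k * rooks q r (suc p) k * fact k)
        induction r e = subst (λ m → partialWeight q r (suc p) * + ((m ∸ q) !) ≡ Σ q (λ k → z ^ k * rooks q r (suc p) k * + ((m ∸ k) !)))
                              e (rook-expansion q r (suc p) (subst (q ≤_) (sym e) q≤n))
        expand : ∀ z a b c d → (+ 1 + z * a) * (b * c * d) ≡ b * d * c + z * b * d * (a * c)
        expand = solve-∀
      -- position p left empty: the value removal identity restores (n+1-k)!
      free-position : ∀ k → k ≤ q → pickSum rest (λ y r → z ^ k * fact k * rooks q r (suc p) k) ≡ z ^ k * R k * + ((suc n ∸ k) !)
      free-position k k≤q = begin
        pickSum rest (λ y r → z ^ k * fact k * rooks q r (suc p) k) ≡⟨ sym (pickSum-*ˡ rest (z ^ k * fact k) (λ y r → rooks q r (suc p) k)) ⟩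
        z ^ k * fact k * pickSum rest (λ y r → rooks q r (suc p) k)  ≡⟨ cong (z ^ k * fact k *_) (rooks-removal q rest (suc p) k) ⟩
        z ^ k * fact k * (+ (suc n ∸ k) * R k)                       ≡⟨ rearrange (z ^ k) (fact k) (+ (suc n ∸ k)) (R k) ⟩
        z ^ k * R k * (+ (suc n ∸ k) * fact k)                       ≡⟨ cong (z ^ k * R k *_) (sym (ZP.pos-* (suc n ∸ k) ((n ∸ k) !))) ⟩
        z ^ k * R k * + ((suc n ∸ k) N.* (n ∸ k) !)                  ≡⟨ cong (λ m → z ^ k * R k * + (m N.* (n ∸ k) !)) suc-n∸k ⟩
        z ^ k * R k * + (suc (n ∸ k) N.* (n ∸ k) !)                  ≡⟨ cong (λ m → z ^ k * R k * + (m !)) (sym suc-n∸k) ⟩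
        z ^ k * R k * + ((suc n ∸ k) !)                              ∎
        where
        rearrange : ∀ a b c d → a * b * (c * d) ≡ a * d * (c * b)
        rearrange = solve-∀
        suc-n∸k : suc n ∸ k ≡ suc (n ∸ k)
        suc-n∸k = NP.+-∸-assoc 1 (NP.≤-trans k≤q q≤n)
      -- no placement of q+1 rooks on q positions; then split off k = 0
      shift-index : Σ q (λ k → z ^ k * R k * + ((suc n ∸ k) !)) ≡ z ^ 0 * rooks (suc q) rest p 0 * + ((suc n) !) + Σ q (λ k → z ^ suc k * R (suc k) * fact k)
      shift-index = begin
        Σ q G                  ≡⟨ sym (ZP.+-identityʳ _) ⟩
        Σ q G + + 0            ≡⟨ cong (λ t → Σ q G + t) (sym (G-vanishes (rooks-too-many q rest (suc p) (suc q) NP.≤-refl))) ⟩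
        Σ (suc q) G            ≡⟨ Σ-head q G ⟩
        G 0 + Σ q (λ k → G (suc k)) ∎
        where
        G : ℕ → ℤ
        G k = z ^ k * R k * + ((suc n ∸ k) !)
        G-vanishes : R (suc q) ≡ + 0 → G (suc q) ≡ + 0
        G-vanishes e = trans (cong (λ t → z ^ suc q * t * + ((suc n ∸ suc q) !)) e)
                             (trans (cong (_* + ((suc n ∸ suc q) !)) (ZP.*-zeroʳ (z ^ suc q))) (ZP.*-zeroˡ (+ ((suc n ∸ suc q) !))))
      recombine : ∀ k → z ^ suc k * R (suc k) * fact k + z ^ suc k * fact k * σ k ≡ z ^ suc k * rooks (suc q) rest p (suc k) * fact k
      recombine k = distribute (z ^ suc k) (R (suc k)) (σ k) (fact k)
        where
        distribute : ∀ a r s f → a * r * f + a * f * s ≡ a * (r + s) * f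
        distribute = solve-∀

    permutation-expansion : ∀ rest p →
      sumOver (wordWeight p) (perms rest) ≡ Σ (length rest) (λ k → z ^ k * rooks (length rest) rest p k * + ((length rest ∸ k) !))
    permutation-expansion rest p = begin
      sumOver (wordWeight p) (perms rest)            ≡⟨ permutation-weights (length rest) rest p refl ⟩
      partialWeight n rest p                         ≡⟨ sym (ZP.*-identityʳ _) ⟩
      partialWeight n rest p * + (0 !)               ≡⟨ cong (λ m → partialWeight n rest p * + (m !)) (sym (NP.n∸n≡0 n)) ⟩
      partialWeight n rest p * + ((n ∸ n) !)         ≡⟨ rook-expansion n rest p NP.≤-refl ⟩
      Σ n (λ k → z ^ k * rooks n rest p k * + ((n ∸ k) !)) ∎
      where
      open ≡-Reasoning
      n = length rest

  ≡ᵇ-refl : ∀ n → (n ≡ᵇ n) ≡ true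
  ≡ᵇ-refl zero    = refl
  ≡ᵇ-refl (suc n) = ≡ᵇ-refl n

  ≢⇒≡ᵇ-false : ∀ m n → m ≢ n → (m ≡ᵇ n) ≡ false
  ≢⇒≡ᵇ-false zero    zero    m≢n = ⊥-elim (m≢n refl)
  ≢⇒≡ᵇ-false zero    (suc n) _   = refl
  ≢⇒≡ᵇ-false (suc m) zero    _   = refl
  ≢⇒≡ᵇ-false (suc m) (suc n) m≢n = ≢⇒≡ᵇ-false m n (m≢n ∘ cong suc)

  ind-∧ : ∀ a b → ind (a ∧ b) ≡ ind a * ind b
  ind-∧ true  b = sym (ZP.*-identityˡ (ind b))
  ind-∧ false b = refl

  filter-count : ∀ (P : List ℕ → Bool) L → + length (filterᵇ P L) ≡ sumOver (ind ∘ P) L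
  filter-count P []      = refl
  filter-count P (σ ∷ L) with P σ
  ... | true  = cong (λ t → + 1 + t) (filter-count P L)
  ... | false = trans (filter-count P L) (sym (ZP.+-identityˡ _))

  upTo-range : ∀ n → upTo n ≡ range 0 n
  upTo-range n = applyUpTo-range n (λ i → i) 0 (λ i → refl)
    where
    applyUpTo-range : ∀ q f p → (∀ i → f i ≡ p N.+ i) → applyUpTo f q ≡ range p q
    applyUpTo-range zero    f p hf = refl
    applyUpTo-range (suc q) f p hf = cong₂ _∷_ (trans (hf 0) (NP.+-identityʳ p))
      (applyUpTo-range q (λ i → f (suc i)) (suc p) (λ i → trans (hf (suc i)) (NP.+-suc p i)))

  -- The test "σ avoids the board", written as in the definitions of V and U.
  avoids : (ℕ × ℕ → Bool) → (ℕ → ℕ) → List ℕ → Bool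
  avoids ok f σ = and (map ok (zip (applyUpTo f (length σ)) σ))

  module InclusionExclusion (forbidden : ℕ → ℕ → Bool) where

    open Rooks forbidden
    open RookExpansion forbidden -1ℤ

    -- With z = -1 the weight of a word is the indicator that it avoids the board.
    avoids-weight : ∀ ok → (∀ i y → ok (i , y) ≡ not (forbidden i y)) →
      ∀ σ f p → (∀ i → f i ≡ p N.+ i) → ind (avoids ok f σ) ≡ wordWeight p σ
    avoids-weight ok hok []      f p hf = refl
    avoids-weight ok hok (y ∷ σ) f p hf = begin
      ind (ok (f 0 , y) ∧ avoids ok (f ∘ suc) σ)
        ≡⟨ ind-∧ (ok (f 0 , y)) _ ⟩
      ind (ok (f 0 , y)) * ind (avoids ok (f ∘ suc) σ)
        ≡⟨ cong₂ _*_ first (avoids-weight ok hok σ (f ∘ suc) (suc p) (λ i → trans (hf (suc i)) (NP.+-suc p i))) ⟩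
      weight p y * wordWeight (suc p) σ ∎
      where
      open ≡-Reasoning
      allowed : ∀ b → ind (not b) ≡ + 1 + -1ℤ * ind b
      allowed true  = refl
      allowed false = refl
      first : ind (ok (f 0 , y)) ≡ weight p y
      first = trans (cong (λ i → ind (ok (i , y))) (trans (hf 0) (NP.+-identityʳ p)))
                    (trans (cong ind (hok p y)) (allowed (forbidden p y)))

    count : ∀ (test : List ℕ → Bool) n → (∀ σ → length σ ≡ n → ind (test σ) ≡ wordWeight 0 σ) →
      + length (filterᵇ test (perms (upTo n))) ≡ Σ n (λ k → -1ℤ ^ k * rooks n (range 0 n) 0 k * + ((n ∸ k) !))
    count test n avoiding = begin
      + length (filterᵇ test (perms (upTo n)))
        ≡⟨ filter-count test (perms (upTo n)) ⟩
      sumOver (ind ∘ test) (perms (upTo n))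
        ≡⟨ cong (λ L → sumOver (ind ∘ test) (perms L)) (upTo-range n) ⟩
      sumOver (ind ∘ test) (perms (range 0 n))
        ≡⟨ sumOver-perms-cong n (range 0 n) (length-range 0 n) _ _ avoiding ⟩
      sumOver (wordWeight 0) (perms (range 0 n))
        ≡⟨ permutation-expansion (range 0 n) 0 ⟩
      Σ (length (range 0 n)) (λ k → -1ℤ ^ k * rooks (length (range 0 n)) (range 0 n) 0 k * + ((length (range 0 n) ∸ k) !))
        ≡⟨ cong (λ m → Σ m (λ k → -1ℤ ^ k * rooks m (range 0 n) 0 k * + ((m ∸ k) !))) (length-range 0 n) ⟩
      Σ n (λ k → -1ℤ ^ k * rooks n (range 0 n) 0 k * + ((n ∸ k) !)) ∎
      where open ≡-Reasoning

  straight : ℕ → ℕ → Bool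
  straight p y = (y ≡ᵇ p) ∨ (y ≡ᵇ suc p)

  module Straight = Rooks straight

  straight-diagonal : ∀ p → straight p p ≡ true
  straight-diagonal p rewrite ≡ᵇ-refl p = refl

  straight-next : ∀ p → straight p (suc p) ≡ true
  straight-next p rewrite ≡ᵇ-refl p = ∨-zeroʳ _

  straight-below : ∀ p i → suc p ≤ i → straight i p ≡ false
  straight-below p i le rewrite ≢⇒≡ᵇ-false p i (NP.<⇒≢ le) | ≢⇒≡ᵇ-false p (suc i) (NP.<⇒≢ (NP.m≤n⇒m≤1+n le)) = refl

  straight-far : ∀ p j → straight p (suc (suc p) N.+ j) ≡ false
  straight-far p j rewrite ≢⇒≡ᵇ-false (suc (suc p) N.+ j) p (NP.>⇒≢ (s≤s (NP.m≤n⇒m≤1+n (NP.m≤m+n p j))))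
                         | ≢⇒≡ᵇ-false (suc p N.+ j) p (NP.>⇒≢ (s≤s (NP.m≤m+n p j))) = refl

  -- Positions p … p+q-1 against values p … p+q-1 form a staircase of 2q
  -- cells, and with the first value p removed one of 2q+1 cells: their rook
  -- numbers are path numbers.  Position p either stays empty (and its
  -- diagonal value p becomes unusable later), or takes p or p+1.
  mutual
    straight-rooks : ∀ q p k → Straight.rooks q (range p q) p k ≡ + path (twice q) k
    straight-rooks zero    p zero    = refl
    straight-rooks zero    p (suc k) = refl
    straight-rooks (suc q) p zero    = Straight.rooks-none (suc q) (range p (suc q)) p
    straight-rooks (suc q) p (suc k) = begin
      Straight.rooks q (p ∷ range (suc p) q) (suc p) (suc k)
        + (ind (straight p p) * Straight.rooks q (range (suc p) q) (suc p) k + pickSum (range (suc p) q) (placed q))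
        ≡⟨ cong₂ _+_ (trans (Straight.rooks-unused p q (suc p) (suc k) [] (range (suc p) q) (straight-below p)) (straight-rooks q (suc p) (suc k)))
                     (cong₂ _+_ (trans (cong (λ b → ind b * Straight.rooks q (range (suc p) q) (suc p) k) (straight-diagonal p))
                                       (trans (ZP.*-identityˡ _) (straight-rooks q (suc p) k)))
                                (on-next q)) ⟩
      + path (twice q) (suc k) + (+ path (twice q) k + + path′ q)
        ≡⟨ cong +_ (collect q) ⟩
      + path (twice (suc q)) (suc k) ∎
      where
      open ≡-Reasoning
      placed : ℕ → ℕ → List ℕ → ℤ
      placed q y r = ind (straight p y) * Straight.rooks q (p ∷ r) (suc p) k
      path′ : ℕ → ℕ
      path′ zero     = 0
      path′ (suc q′) = path (suc (twice q′)) k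
      on-next : ∀ q → pickSum (range (suc p) q) (placed q) ≡ + path′ q
      on-next zero     = refl
      on-next (suc q′) = begin
        ind (straight p (suc p)) * Straight.rooks (suc q′) (p ∷ range (suc (suc p)) q′) (suc p) k
          + pickSum (range (suc (suc p)) q′) (λ y r → placed (suc q′) y (suc p ∷ r))
          ≡⟨ cong₂ _+_ (trans (cong (λ b → ind b * Straight.rooks (suc q′) (p ∷ range (suc (suc p)) q′) (suc p) k) (straight-next p))
                              (trans (ZP.*-identityˡ _) (trans (Straight.rooks-unused p (suc q′) (suc p) k [] (range (suc (suc p)) q′) (straight-below p))
                                                               (straight-rooks-shifted q′ (suc p) k))))
                       (Straight.row-avoids-range p (suc (suc p)) q′ (λ y r → Straight.rooks (suc q′) (p ∷ suc p ∷ r) (suc p) k) (straight-far p)) ⟩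
        + path (suc (twice q′)) k + + 0 ≡⟨ ZP.+-identityʳ _ ⟩
        + path (suc (twice q′)) k ∎
      collect : ∀ q → path (twice q) (suc k) N.+ (path (twice q) k N.+ path′ q) ≡ path (twice (suc q)) (suc k)
      collect zero     = NP.+-identityʳ (path 0 k)
      collect (suc q′) = swap-last (path (suc (suc (twice q′))) (suc k)) (path (suc (suc (twice q′))) k) (path (suc (twice q′)) k)
        where
        swap-last : ∀ a b c → a N.+ (b N.+ c) ≡ a N.+ c N.+ b
        swap-last a b c = trans (cong (a N.+_) (NP.+-comm b c)) (sym (NP.+-assoc a c b))

    straight-rooks-shifted : ∀ q p k → Straight.rooks (suc q) (range (suc p) q) p k ≡ + path (suc (twice q)) k
    straight-rooks-shifted q       p zero    = Straight.rooks-none (suc q) (range (suc p) q) p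
    straight-rooks-shifted zero    p (suc k) = refl
    straight-rooks-shifted (suc q) p (suc k) = begin
      Straight.rooks (suc q) (range (suc p) (suc q)) (suc p) (suc k)
        + (ind (straight p (suc p)) * Straight.rooks (suc q) (range (suc (suc p)) q) (suc p) k
           + pickSum (range (suc (suc p)) q) (λ y r → ind (straight p y) * Straight.rooks (suc q) (suc p ∷ r) (suc p) k))
        ≡⟨ cong₂ _+_ (straight-rooks (suc q) (suc p) (suc k))
                     (cong₂ _+_ (trans (cong (λ b → ind b * Straight.rooks (suc q) (range (suc (suc p)) q) (suc p) k) (straight-next p))
                                       (trans (ZP.*-identityˡ _) (straight-rooks-shifted q (suc p) k)))
                                (Straight.row-avoids-range p (suc (suc p)) q (λ y r → Straight.rooks (suc q) (suc p ∷ r) (suc p) k) (straight-far p))) ⟩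
      + path (twice (suc q)) (suc k) + (+ path (suc (twice q)) k + + 0)
        ≡⟨ cong (λ t → + path (twice (suc q)) (suc k) + t) (ZP.+-identityʳ (+ path (suc (twice q)) k)) ⟩
      + path (suc (twice (suc q))) (suc k) ∎
      where open ≡-Reasoning

  V-formula : ∀ n → + V n ≡ Σ n (λ k → -1ℤ ^ k * + path (twice n) k * + ((n ∸ k) !))
  V-formula n = begin
    + V n
      ≡⟨ InclusionExclusion.count straight isStraight n (λ σ _ → avoids-weight straight-ok straight-ok-not σ (λ i → i) 0 (λ i → refl)) ⟩
    Σ n (λ k → -1ℤ ^ k * Straight.rooks n (range 0 n) 0 k * + ((n ∸ k) !))
      ≡⟨ Σ-cong n (λ k → cong (λ t → -1ℤ ^ k * t * + ((n ∸ k) !)) (straight-rooks n 0 k)) ⟩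
    Σ n (λ k → -1ℤ ^ k * + path (twice n) k * + ((n ∸ k) !)) ∎
    where
    open ≡-Reasoning
    open InclusionExclusion straight using (avoids-weight)
    straight-ok : ℕ × ℕ → Bool
    straight-ok (i , p) = not (p ≡ᵇ i) ∧ not (p ≡ᵇ suc i)
    straight-ok-not : ∀ i y → straight-ok (i , y) ≡ not (straight i y)
    straight-ok-not i y with y ≡ᵇ i
    ... | true  = refl
    ... | false = refl

  -- The ordinary ménage board of size n: π(i) = i and π(i) = i+1 mod n are
  -- forbidden.  It differs from the straight board only in the cell
  -- (n-1, 0) and in the unused cell (n-1, n).

  module Ordinary (n : ℕ) where

    successor : ℕ → ℕ
    successor i = if suc i ≡ᵇ n then 0 else suc i

    board : ℕ → ℕ → Bool
    board p y = (y ≡ᵇ p) ∨ (y ≡ᵇ successor p)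

    open Rooks board public

    successor-last : ∀ {p} → suc p ≡ n → successor p ≡ 0
    successor-last {p} refl rewrite ≡ᵇ-refl p = refl

    successor-inner : ∀ {p} → suc p ≢ n → successor p ≡ suc p
    successor-inner {p} ne rewrite ≢⇒≡ᵇ-false (suc p) n ne = refl

    board-diagonal : ∀ p → board p p ≡ true
    board-diagonal p rewrite ≡ᵇ-refl p = refl

    board-next : ∀ {p} → suc p ≢ n → board p (suc p) ≡ true
    board-next {p} ne rewrite successor-inner ne | ≡ᵇ-refl p = ∨-zeroʳ _

    board-wrap : ∀ {p} → suc p ≡ n → board p 0 ≡ true
    board-wrap {p} e rewrite successor-last e = ∨-zeroʳ _

    board-zero : ∀ {p} → 1 ≤ p → suc p ≢ n → board p 0 ≡ false
    board-zero {suc p} _ ne rewrite successor-inner ne = refl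

    board-below : ∀ d → 1 ≤ d → ∀ i → suc d ≤ i → board i d ≡ false
    board-below (suc d) _ i le with suc i ≡ᵇ n
    ... | true  rewrite ≢⇒≡ᵇ-false (suc d) i (NP.<⇒≢ le) = refl
    ... | false rewrite ≢⇒≡ᵇ-false (suc d) i (NP.<⇒≢ le) | ≢⇒≡ᵇ-false d i (NP.<⇒≢ (NP.≤-trans (NP.n≤1+n (suc d)) le)) = refl

    board-far : ∀ {p} → suc p ≢ n → ∀ j → board p (suc (suc p) N.+ j) ≡ false
    board-far {p} ne j rewrite successor-inner ne
                             | ≢⇒≡ᵇ-false (suc (suc p) N.+ j) p (NP.>⇒≢ (s≤s (NP.m≤n⇒m≤1+n (NP.m≤m+n p j))))
                             | ≢⇒≡ᵇ-false (suc p N.+ j) p (NP.>⇒≢ (s≤s (NP.m≤m+n p j))) = refl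

    board-straight : ∀ i y → 1 ≤ i → (1 ≤ y × y < n) → board i y ≡ straight i y
    board-straight i (suc y) _ (_ , y<n) with suc i ≡ᵇ n in eq
    ... | true  rewrite ≢⇒≡ᵇ-false y i (NP.<⇒≢ (NP.≤-pred (subst (suc (suc y) ≤_) (sym (NP.≡ᵇ⇒≡ (suc i) n (subst T (sym eq) tt))) y<n))) = refl
    ... | false = refl

    not-last : ∀ {p q} → p N.+ suc (suc q) ≡ n → suc p ≢ n
    not-last {p} {q} e e′ = NP.<-irrefl refl
      (subst (suc p <_) (trans e (sym e′)) (subst (suc p <_) (sym (NP.+-suc p (suc q))) (s≤s (NP.m<m+n p (s≤s z≤n)))))

    last : ∀ {p} → p N.+ 1 ≡ n → suc p ≡ n
    last {p} e = trans (sym (NP.+-comm p 1)) e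

    -- The value 0 is only forbidden at the last position, so for p ≥ 1 the
    -- value p is unusable once position p is passed.
    drop-passed : ∀ q p k S → 1 ≤ p → rooks q (0 ∷ p ∷ S) (suc p) k ≡ rooks q (0 ∷ S) (suc p) k
    drop-passed q p k S p≥1 = rooks-unused p q (suc p) k (0 ∷ []) S (board-below p p≥1)

    -- Positions p … n-1 against values 0, p, …, n-1 (resp. 0, p+1, …, n-1):
    -- a staircase of 2(n-p)+1 (resp. 2(n-p)) cells closed up by the
    -- wrap-around cell (n-1, 0).
    mutual
      rooks-closed : ∀ q p k → 1 ≤ p → p N.+ suc q ≡ n → rooks (suc q) (0 ∷ range p (suc q)) p k ≡ + path (suc (twice (suc q))) k
      rooks-closed q       p zero          _   _ = rooks-none (suc q) _ p
      rooks-closed zero    p (suc zero)    p≥1 e rewrite board-wrap (last e) | board-diagonal p = refl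
      rooks-closed zero    p (suc (suc k)) p≥1 e rewrite board-wrap (last e) | board-diagonal p = refl
      rooks-closed (suc q) p (suc k)       p≥1 e = begin
        rooks (suc q) (0 ∷ p ∷ S1) (suc p) (suc k) + (F 0 (p ∷ S1) + (F p (0 ∷ S1) + (F (suc p) (0 ∷ p ∷ S2) + pickSum S2 (λ y r → F y (0 ∷ p ∷ suc p ∷ r)))))
          ≡⟨ cong₂ _+_ (trans (drop-passed (suc q) p (suc k) S1 p≥1) (rooks-closed q (suc p) (suc k) (s≤s z≤n) e′))
              (cong₂ _+_ (excluded 0 (p ∷ S1) (board-zero p≥1 ne))
              (cong₂ _+_ (trans (included p (0 ∷ S1) (board-diagonal p)) (rooks-closed q (suc p) k (s≤s z≤n) e′))
              (cong₂ _+_ (trans (included (suc p) (0 ∷ p ∷ S2) (board-next ne)) (trans (drop-passed (suc q) p k S2 p≥1) (rooks-open q (suc p) k (s≤s z≤n) e′)))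
                         (row-avoids-range p (suc (suc p)) q (λ y r → rooks (suc q) (0 ∷ p ∷ suc p ∷ r) (suc p) k) (board-far ne))))) ⟩
        + α + (+ 0 + (+ β + (+ γ + + 0)))
          ≡⟨ cong +_ (collect α β γ) ⟩
        + path (suc (twice (suc (suc q)))) (suc k) ∎
        where
        open ≡-Reasoning
        S2 = range (suc (suc p)) q
        S1 = suc p ∷ S2
        F : ℕ → List ℕ → ℤ
        F y r = ind (board p y) * rooks (suc q) r (suc p) k
        included : ∀ y r → board p y ≡ true → F y r ≡ rooks (suc q) r (suc p) k
        included y r b = trans (cong (λ t → ind t * rooks (suc q) r (suc p) k) b) (ZP.*-identityˡ _)
        excluded : ∀ y r → board p y ≡ false → F y r ≡ + 0
        excluded y r b = trans (cong (λ t → ind t * rooks (suc q) r (suc p) k) b) (ZP.*-zeroˡ (rooks (suc q) r (suc p) k))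
        e′ : suc p N.+ suc q ≡ n
        e′ = trans (sym (NP.+-suc p (suc q))) e
        ne = not-last e
        α = path (suc (twice (suc q))) (suc k)
        β = path (suc (twice (suc q))) k
        γ = path (twice (suc q)) k
        collect : ∀ a b c → a N.+ (0 N.+ (b N.+ (c N.+ 0))) ≡ a N.+ c N.+ b
        collect a b c rewrite NP.+-identityʳ c = trans (cong (a N.+_) (NP.+-comm b c)) (sym (NP.+-assoc a c b))

      rooks-open : ∀ q p k → 1 ≤ p → p N.+ suc q ≡ n → rooks (suc q) (0 ∷ range (suc p) q) p k ≡ + path (twice (suc q)) k
      rooks-open q       p zero          _   _ = rooks-none (suc q) _ p
      rooks-open zero    p (suc zero)    p≥1 e rewrite board-wrap (last e) = refl
      rooks-open zero    p (suc (suc k)) p≥1 e rewrite board-wrap (last e) = refl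
      rooks-open (suc q) p (suc k)       p≥1 e = begin
        rooks (suc q) (0 ∷ S1) (suc p) (suc k) + (F 0 S1 + (F (suc p) (0 ∷ S2) + pickSum S2 (λ y r → F y (0 ∷ suc p ∷ r))))
          ≡⟨ cong₂ _+_ (rooks-closed q (suc p) (suc k) (s≤s z≤n) e′)
              (cong₂ _+_ (excluded 0 S1 (board-zero p≥1 ne))
              (cong₂ _+_ (trans (included (suc p) (0 ∷ S2) (board-next ne)) (rooks-open q (suc p) k (s≤s z≤n) e′))
                         (row-avoids-range p (suc (suc p)) q (λ y r → rooks (suc q) (0 ∷ suc p ∷ r) (suc p) k) (board-far ne)))) ⟩
        + α + (+ 0 + (+ γ + + 0))
          ≡⟨ cong +_ (cong (α N.+_) (NP.+-identityʳ γ)) ⟩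
        + path (twice (suc (suc q))) (suc k) ∎
        where
        open ≡-Reasoning
        S2 = range (suc (suc p)) q
        S1 = suc p ∷ S2
        F : ℕ → List ℕ → ℤ
        F y r = ind (board p y) * rooks (suc q) r (suc p) k
        included : ∀ y r → board p y ≡ true → F y r ≡ rooks (suc q) r (suc p) k
        included y r b = trans (cong (λ t → ind t * rooks (suc q) r (suc p) k) b) (ZP.*-identityˡ _)
        excluded : ∀ y r → board p y ≡ false → F y r ≡ + 0
        excluded y r b = trans (cong (λ t → ind t * rooks (suc q) r (suc p) k) b) (ZP.*-zeroˡ (rooks (suc q) r (suc p) k))
        e′ : suc p N.+ suc q ≡ n
        e′ = trans (sym (NP.+-suc p (suc q))) e
        ne = not-last e
        α = path (suc (twice (suc q))) (suc k)
        γ = path (twice (suc q)) k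

  -- cyclic n k: the rook numbers of the ordinary board of size n ≥ 2,
  -- (2n/(2n-k)) (2n-k choose k) in closed form.
  cyclic : ℕ → ℕ → ℕ
  cyclic n zero    = 1
  cyclic n (suc k) = path (twice n) (suc k) N.+ path (twice (n ∸ 1)) k

  -- Position 0 either stays empty (leaving the closed staircase of
  -- 2n-1 cells), or takes value 0 or 1 (leaving a staircase of 2n-2 cells).
  ordinary-rooks : ∀ n₂ k → let n = suc (suc n₂) in Ordinary.rooks n n (range 0 n) 0 k ≡ + cyclic n k
  ordinary-rooks n₂ zero    = Ordinary.rooks-none (suc (suc n₂)) (suc (suc n₂)) (range 0 (suc (suc n₂))) 0
  ordinary-rooks n₂ (suc k) = begin
    rooks (suc n₂) (0 ∷ S1) 1 (suc k) + (F 0 S1 + (F 1 (0 ∷ S2) + pickSum S2 (λ y r → F y (0 ∷ 1 ∷ r))))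
      ≡⟨ cong₂ _+_ (rooks-closed n₂ 1 (suc k) (s≤s z≤n) refl)
          (cong₂ _+_ (trans (on-diagonal 0 S1 (board-diagonal 0)) (trans as-straight (straight-rooks (suc n₂) 1 k)))
          (cong₂ _+_ (trans (on-diagonal 1 (0 ∷ S2) (board-next {0} (λ ()))) (rooks-open n₂ 1 k (s≤s z≤n) refl))
                     (row-avoids-range 0 2 n₂ (λ y r → rooks (suc n₂) (0 ∷ 1 ∷ r) 1 k) (board-far {0} (λ ()))))) ⟩
    + α + (+ γ + (+ γ + + 0))
      ≡⟨ cong +_ (regroup α γ) ⟩
    + cyclic n (suc k) ∎
    where
    n = suc (suc n₂)
    open ≡-Reasoning
    open Ordinary n
    S2 = range 2 n₂
    S1 = 1 ∷ S2
    F : ℕ → List ℕ → ℤ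
    F y r = ind (board 0 y) * rooks (suc n₂) r 1 k
    on-diagonal : ∀ y r → board 0 y ≡ true → F y r ≡ rooks (suc n₂) r 1 k
    on-diagonal y r b = trans (cong (λ t → ind t * rooks (suc n₂) r 1 k) b) (ZP.*-identityˡ _)
    as-straight : rooks (suc n₂) S1 1 k ≡ Straight.rooks (suc n₂) S1 1 k
    as-straight = rooks-cong board straight (λ y → 1 ≤ y × y < n) (suc n₂) S1 1 k (all-range 1 (suc n₂)) (λ i y le gy → board-straight i y le gy)
    α = path (suc (twice (suc n₂))) (suc k)
    γ = path (twice (suc n₂)) k
    regroup : ∀ a c → a N.+ (c N.+ (c N.+ 0)) ≡ a N.+ c N.+ c
    regroup a c rewrite NP.+-identityʳ c = sym (NP.+-assoc a c c)

  U-formula : ∀ n₂ → let n = suc (suc n₂) in + U n ≡ Σ n (λ k → -1ℤ ^ k * + cyclic n k * + ((n ∸ k) !))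
  U-formula n₂ = begin
    + U n
      ≡⟨ InclusionExclusion.count board isOrdinary n (λ σ e → subst (λ m → ind (avoids (ordinary-ok m) (λ i → i) σ) ≡ wordWeight 0 σ) (sym e)
                                                                     (avoids-weight (ordinary-ok n) ordinary-ok-not σ (λ i → i) 0 (λ i → refl))) ⟩
    Σ n (λ k → -1ℤ ^ k * rooks n (range 0 n) 0 k * + ((n ∸ k) !))
      ≡⟨ Σ-cong n (λ k → cong (λ t → -1ℤ ^ k * t * + ((n ∸ k) !)) (ordinary-rooks n₂ k)) ⟩
    Σ n (λ k → -1ℤ ^ k * + cyclic n k * + ((n ∸ k) !)) ∎
    where
    n = suc (suc n₂)
    open ≡-Reasoning
    open Ordinary n using (board; rooks)
    open InclusionExclusion board using (avoids-weight)
    open RookExpansion board -1ℤ using (wordWeight)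
    ordinary-ok : ℕ → ℕ × ℕ → Bool
    ordinary-ok m (i , p) = not (p ≡ᵇ i) ∧ not (p ≡ᵇ (if suc i ≡ᵇ m then 0 else suc i))
    ordinary-ok-not : ∀ i y → ordinary-ok n (i , y) ≡ not (board i y)
    ordinary-ok-not i y with y ≡ᵇ i
    ... | true  = refl
    ... | false = refl

  factorials : Ser
  factorials j = + (j !)

  Q-coefficients : ∀ a d → Σ d (λ k → (sign k * + multiset a k) * (c ^ˢ (twice k N.+ a)) (d ∸ k)) ≡ oneS d
  Q-coefficients a d = begin
    Σ d (λ k → (sign k * + multiset a k) * (c ^ˢ (twice k N.+ a)) (d ∸ k))
      ≡⟨ Σ-cong d (λ k → sym (term k (d ∸ k))) ⟩
    SX (λ k → ((sign k * + multiset a k) · (c ^ˢ twice k)) ⊛ c ^ˢ a) d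
      ≡⟨ sym (SX-⊛ (λ k → (sign k * + multiset a k) · (c ^ˢ twice k)) (c ^ˢ a) d) ⟩
    (Q a ⊛ c ^ˢ a) d   ≡⟨ ⊛-comm (Q a) (c ^ˢ a) d ⟩
    (c ^ˢ a ⊛ Q a) d   ≡⟨ c^a-times-Q a d ⟩
    oneS d ∎
    where
    open ≡-Reasoning
    term : ∀ k → ((sign k * + multiset a k) · (c ^ˢ twice k)) ⊛ c ^ˢ a ≈ (sign k * + multiset a k) · (c ^ˢ (twice k N.+ a))
    term k = ≈-trans (·-⊛ (sign k * + multiset a k) (c ^ˢ twice k) (c ^ˢ a)) (·-cong (sign k * + multiset a k) (≈-sym (^ˢ-+ c (twice k) a)))

  -- Coefficientwise over ℤ: substitute V-formula, collect the terms with
  -- n - k = j, and each collection sums to j! by Q-coefficients.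
  straight-identity : ∀ m → + (m !) ≡ Σ m (λ n → + V n * (c ^ˢ suc (twice n)) (m ∸ n))
  straight-identity m = sym (begin
    Σ m (λ n → + V n * P n (m ∸ n))
      ≡⟨ Σ-cong m (λ n → cong (_* P n (m ∸ n)) (V-formula n)) ⟩
    Σ m (λ n → Σ n (λ k → sign k * + path (twice n) k * + ((n ∸ k) !)) * P n (m ∸ n))
      ≡⟨ Σ-cong m (λ n → Σ-*ʳ n (P n (m ∸ n)) _) ⟩
    Σ m (λ n → Σ n (H n))
      ≡⟨ Σ-by-difference m H ⟩
    Σ m (λ j → Σ (m ∸ j) (λ k → H (k N.+ j) k))
      ≡⟨ Σ-cong m (λ j → trans (Σ-cong (m ∸ j) (regroup j)) (sym (Σ-*ˡ (m ∸ j) (factorials j) _))) ⟩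
    Σ m (λ j → factorials j * Σ (m ∸ j) (λ k → (sign k * + multiset (suc (twice j)) k) * (c ^ˢ (twice k N.+ suc (twice j))) (m ∸ j ∸ k)))
      ≡⟨ Σ-cong m (λ j → cong (factorials j *_) (Q-coefficients (suc (twice j)) (m ∸ j))) ⟩
    (factorials ⊛ oneS) m
      ≡⟨ ⊛-one factorials m ⟩
    + (m !) ∎)
    where
    open ≡-Reasoning
    P : ℕ → Ser
    P n = c ^ˢ suc (twice n)
    H : ℕ → ℕ → ℤ
    H n k = sign k * + path (twice n) k * + ((n ∸ k) !) * P n (m ∸ n)
    rearrange : ∀ s b f p → s * b * f * p ≡ f * (s * b * p)
    rearrange = solve-∀
    -- the terms with n - k = j: path(2(k+j), k) = multiset(2j+1, k), and c^{2n+1} = c^{2k} c^{2j+1}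
    regroup : ∀ j k → H (k N.+ j) k ≡ factorials j * ((sign k * + multiset (suc (twice j)) k) * (c ^ˢ (twice k N.+ suc (twice j))) (m ∸ j ∸ k))
    regroup j k = begin
      sign k * + path (twice (k N.+ j)) k * + (((k N.+ j) ∸ k) !) * (c ^ˢ suc (twice (k N.+ j))) (m ∸ (k N.+ j))
        ≡⟨ cong₂ (λ x y → sign k * + x * + (y !) * (c ^ˢ suc (twice (k N.+ j))) (m ∸ (k N.+ j)))
                 (trans (cong (λ t → path t k) (twice-+ k j)) (path-multiset k (twice j))) (NP.m+n∸m≡n k j) ⟩
      sign k * + multiset (suc (twice j)) k * factorials j * (c ^ˢ suc (twice (k N.+ j))) (m ∸ (k N.+ j))
        ≡⟨ cong₂ (λ e t → sign k * + multiset (suc (twice j)) k * factorials j * (c ^ˢ e) t)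
                 (trans (cong suc (twice-+ k j)) (sym (NP.+-suc (twice k) (twice j))))
                 (trans (cong (m ∸_) (NP.+-comm k j)) (sym (NP.∸-+-assoc m j k))) ⟩
      sign k * + multiset (suc (twice j)) k * factorials j * (c ^ˢ (twice k N.+ suc (twice j))) (m ∸ j ∸ k)
        ≡⟨ rearrange (sign k) (+ multiset (suc (twice j)) k) (factorials j) _ ⟩
      factorials j * ((sign k * + multiset (suc (twice j)) k) * (c ^ˢ (twice k N.+ suc (twice j))) (m ∸ j ∸ k)) ∎

  c-times-Q₁ : c ⊛ Q 1 ≈ oneS
  c-times-Q₁ = ≈-trans (⊛-congˡ (Q 1) (≈-sym (⊛-one c))) (c^a-times-Q 1)

  1-xc² : oneS ⊖ X (c ⊛ c) ≈ + 2 · oneS ⊖ c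
  1-xc² m = begin
    oneS m - X (c ⊛ c) m                     ≡⟨ rearrange (oneS m) (X (c ⊛ c) m) ⟩
    + 2 * oneS m - (oneS m + X (c ⊛ c) m)    ≡⟨ cong (λ t → + 2 * oneS m - t) (sym (catalan-equation m)) ⟩
    + 2 * oneS m - c m                       ∎
    where
    open ≡-Reasoning
    rearrange : ∀ o x → o - x ≡ + 2 * o - (o + x)
    rearrange = solve-∀

  -- c' (2 Q₁ - 1) = c², from c' (2 - c) = c³ and c Q₁ = 1.
  ∂c-times-[2Q₁-1] : ∂ c ⊛ (+ 2 · Q 1 ⊖ oneS) ≈ c ⊛ c
  ∂c-times-[2Q₁-1] = begin
    ∂ c ⊛ Y                          ≈⟨ ⊛-congʳ (∂ c) (≈-trans (≈-sym (⊛-one Y)) (⊛-congʳ Y (≈-sym c-times-Q₁))) ⟩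
    ∂ c ⊛ (Y ⊛ (c ⊛ Q 1))            ≈⟨ ⊛-congʳ (∂ c) (≈-sym (⊛-assoc Y c (Q 1))) ⟩
    ∂ c ⊛ (Y ⊛ c ⊛ Q 1)              ≈⟨ ⊛-congʳ (∂ c) (⊛-congˡ (Q 1) Y-times-c) ⟩
    ∂ c ⊛ ((+ 2 · oneS ⊖ c) ⊛ Q 1)   ≈⟨ ≈-sym (⊛-assoc (∂ c) (+ 2 · oneS ⊖ c) (Q 1)) ⟩
    ∂ c ⊛ (+ 2 · oneS ⊖ c) ⊛ Q 1     ≈⟨ ⊛-congˡ (Q 1) ∂c-times-[2-c] ⟩
    c ⊛ (c ⊛ c) ⊛ Q 1                ≈⟨ ⊛-assoc c (c ⊛ c) (Q 1) ⟩
    c ⊛ ((c ⊛ c) ⊛ Q 1)              ≈⟨ ⊛-congʳ c (⊛-assoc c c (Q 1)) ⟩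
    c ⊛ (c ⊛ (c ⊛ Q 1))              ≈⟨ ⊛-congʳ c (⊛-congʳ c c-times-Q₁) ⟩
    c ⊛ (c ⊛ oneS)                   ≈⟨ ⊛-congʳ c (⊛-one c) ⟩
    c ⊛ c                            ∎
    where
    open ≈-Reasoning
    Y = + 2 · Q 1 ⊖ oneS
    Y-times-c : Y ⊛ c ≈ + 2 · oneS ⊖ c
    Y-times-c m = trans (⊛-distribʳ-⊖ (+ 2 · Q 1) oneS c m)
      (cong₂ _-_ (trans (·-⊛ (+ 2) (Q 1) c m) (cong (+ 2 *_) (trans (⊛-comm (Q 1) c m) (c-times-Q₁ m)))) (one-⊛ c m))

  -- The alternating rook sums Φ n, equal to U n for n ≥ 2.
  Φ : ℕ → ℤ
  Φ n = Σ n (λ k → sign k * + cyclic n k * + ((n ∸ k) !))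

  -- The terms of Σ Φₙ xⁿ c^{2n-2} with n - k = j.
  diagonal : ℕ → Ser
  diagonal j = SX (λ k → (sign k * + cyclic (k N.+ j) k) · (c ^ˢ (twice (k N.+ j) ∸ 2)))

  Φ-series-by-difference : SX (λ n → Φ n · (c ^ˢ (twice n ∸ 2))) ≈ SX (λ j → factorials j · diagonal j)
  Φ-series-by-difference m = begin
    Σ m (λ n → Φ n * P n (m ∸ n))                   ≡⟨ Σ-cong m (λ n → Σ-*ʳ n (P n (m ∸ n)) _) ⟩
    Σ m (λ n → Σ n (H n))                           ≡⟨ Σ-by-difference m H ⟩
    Σ m (λ j → Σ (m ∸ j) (λ k → H (k N.+ j) k))     ≡⟨ Σ-cong m (λ j → trans (Σ-cong (m ∸ j) (regroup j)) (sym (Σ-*ˡ (m ∸ j) (factorials j) _))) ⟩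
    SX (λ j → factorials j · diagonal j) m                 ∎
    where
    open ≡-Reasoning
    P : ℕ → Ser
    P n = c ^ˢ (twice n ∸ 2)
    H : ℕ → ℕ → ℤ
    H n k = sign k * + cyclic n k * + ((n ∸ k) !) * P n (m ∸ n)
    rearrange : ∀ s b f p → s * b * f * p ≡ f * (s * b * p)
    rearrange = solve-∀
    regroup : ∀ j k → H (k N.+ j) k ≡ factorials j * ((sign k * + cyclic (k N.+ j) k) * P (k N.+ j) (m ∸ j ∸ k))
    regroup j k = trans (cong₂ (λ x y → sign k * + cyclic (k N.+ j) k * + (x !) * P (k N.+ j) y)
                               (NP.m+n∸m≡n k j) (trans (cong (m ∸_) (NP.+-comm k j)) (sym (NP.∸-+-assoc m j k))))
                        (rearrange (sign k) _ (factorials j) _)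

  -- Σ_k (-1)ᵏ (B(a,k) + B(a,k-1)) xᵏ c^{2k} = Q a (1 - x c²) = Q a (2 - c),
  -- where B = multiset.
  Q-times-[2-c] : ∀ a →
    SX (λ k → (sign k * (+ multiset a k + previous (λ i → + multiset a i) k)) · (c ^ˢ twice k)) ≈ Q a ⊛ (+ 2 · oneS ⊖ c)
  Q-times-[2-c] a = begin
    SX (λ k → (sign k * (B k + B′ k)) · (c ^ˢ twice k))
      ≈⟨ SX-cong (λ k → ≈-trans (λ m → cong (_* (c ^ˢ twice k) m) (ZP.*-distribˡ-+ (sign k) (B k) (B′ k)))
                                (·-distribʳ (sign k * B k) (sign k * B′ k) (c ^ˢ twice k))) ⟩
    SX (λ k → (sign k * B k) · (c ^ˢ twice k) ⊕ (sign k * B′ k) · (c ^ˢ twice k))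
      ≈⟨ SX-⊕ (λ k → (sign k * B k) · (c ^ˢ twice k)) (λ k → (sign k * B′ k) · (c ^ˢ twice k)) ⟩
    Q a ⊕ SX (λ k → (sign k * B′ k) · (c ^ˢ twice k))
      ≈⟨ ⊕-cong (≈-sym (⊛-one (Q a))) shifted ⟩
    Q a ⊛ oneS ⊕ X (-1ℤ · (Q a ⊛ (c ⊛ c)))
      ≈⟨ (λ m → cong (λ t → (Q a ⊛ oneS) m + t) (trans (X-· -1ℤ (Q a ⊛ (c ⊛ c)) m) (trans (ZP.-1*i≡-i _) (cong -_ (sym (⊛-X (Q a) (c ⊛ c) m)))))) ⟩
    Q a ⊛ oneS ⊖ Q a ⊛ X (c ⊛ c)
      ≈⟨ ≈-sym (⊛-distribˡ-⊖ oneS (X (c ⊛ c)) (Q a)) ⟩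
    Q a ⊛ (oneS ⊖ X (c ⊛ c))
      ≈⟨ ⊛-congʳ (Q a) 1-xc² ⟩
    Q a ⊛ (+ 2 · oneS ⊖ c) ∎
    where
    open ≈-Reasoning
    B B′ : ℕ → ℤ
    B  k = + multiset a k
    B′ k = previous B k
    -- the terms with B(a,k-1) form x c² (−Q a)
    raise : ∀ i → (sign (suc i) * B i) · (c ^ˢ twice (suc i)) ≈ -1ℤ · (((sign i * B i) · (c ^ˢ twice i)) ⊛ (c ⊛ c))
    raise i = ≈-trans (λ m → cong (_* (c ^ˢ twice (suc i)) m) (ZP.*-assoc -1ℤ (sign i) (B i)))
              (≈-trans (·-assoc -1ℤ (sign i * B i) (c ^ˢ twice (suc i)))
              (·-cong -1ℤ (≈-trans (·-cong (sign i * B i) (≈-trans (≈-sym (⊛-assoc c c (c ^ˢ twice i))) (⊛-comm (c ⊛ c) (c ^ˢ twice i))))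
                                   (≈-sym (·-⊛ (sign i * B i) (c ^ˢ twice i) (c ⊛ c))))))
    shifted : SX (λ k → (sign k * B′ k) · (c ^ˢ twice k)) ≈ X (-1ℤ · (Q a ⊛ (c ⊛ c)))
    shifted = ≈-trans (SX-split (λ k → (sign k * B′ k) · (c ^ˢ twice k)))
              (≈-trans (λ m → trans (cong (_+ X (SX (λ i → (sign (suc i) * B i) · (c ^ˢ twice (suc i)))) m) (ZP.*-zeroˡ (oneS m))) (ZP.+-identityˡ _))
              (X-cong (≈-trans (SX-cong raise)
                      (≈-trans (SX-· -1ℤ (λ i → ((sign i * B i) · (c ^ˢ twice i)) ⊛ (c ⊛ c)))
                               (·-cong -1ℤ (≈-sym (SX-⊛ (λ i → (sign i * B i) · (c ^ˢ twice i)) (c ⊛ c))))))))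

  -- For j ≥ 1 the diagonal series is c^{-(2j+3)} (2 - c) c^{2j-2} = c^{-3} (2 - c),
  -- which c' inverts.
  ∂c-times-diagonal : ∀ j → ∂ c ⊛ diagonal (suc j) ≈ oneS
  ∂c-times-diagonal j = begin
    ∂ c ⊛ diagonal (suc j)                 ≈⟨ ⊛-congʳ (∂ c) (≈-trans (SX-cong factor) (≈-sym (SX-⊛ (λ k → s k · (c ^ˢ twice k)) P))) ⟩
    ∂ c ⊛ (SX (λ k → s k · (c ^ˢ twice k)) ⊛ P)  ≈⟨ ⊛-congʳ (∂ c) (⊛-congˡ P (Q-times-[2-c] a)) ⟩
    ∂ c ⊛ (Q a ⊛ W ⊛ P)                    ≈⟨ ⊛-congʳ (∂ c) (⊛-assoc (Q a) W P) ⟩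
    ∂ c ⊛ (Q a ⊛ (W ⊛ P))                  ≈⟨ ⊛-lcomm (∂ c) (Q a) (W ⊛ P) ⟩
    Q a ⊛ (∂ c ⊛ (W ⊛ P))                  ≈⟨ ⊛-congʳ (Q a) (≈-sym (⊛-assoc (∂ c) W P)) ⟩
    Q a ⊛ (∂ c ⊛ W ⊛ P)                    ≈⟨ ⊛-congʳ (Q a) (⊛-congˡ P ∂c-times-[2-c]) ⟩
    Q a ⊛ (c ⊛ (c ⊛ c) ⊛ P)                ≈⟨ ⊛-congʳ (Q a) (⊛-congˡ P (⊛-congʳ c (⊛-congʳ c (≈-sym (⊛-one c))))) ⟩
    Q a ⊛ (c ^ˢ 3 ⊛ P)                     ≈⟨ ⊛-congʳ (Q a) (≈-sym (^ˢ-+ c 3 (twice j))) ⟩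
    Q a ⊛ c ^ˢ a                           ≈⟨ ⊛-comm (Q a) (c ^ˢ a) ⟩
    c ^ˢ a ⊛ Q a                           ≈⟨ c^a-times-Q a ⟩
    oneS                                   ∎
    where
    open ≈-Reasoning
    a = suc (twice (suc j))
    P = c ^ˢ twice j
    W = + 2 · oneS ⊖ c
    s : ℕ → ℤ
    s k = sign k * (+ multiset a k + previous (λ i → + multiset a i) k)
    cyclic-multiset : ∀ k → + cyclic (k N.+ suc j) k ≡ + multiset a k + previous (λ i → + multiset a i) k
    cyclic-multiset zero    = cong +_ (sym (multiset-zero a))
    cyclic-multiset (suc i) = trans (ZP.pos-+ (path (twice (suc i N.+ suc j)) (suc i)) (path (twice (i N.+ suc j)) i))
      (cong₂ _+_ (cong +_ (trans (cong (λ t → path t (suc i)) (twice-+ (suc i) (suc j))) (path-multiset (suc i) (twice (suc j)))))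
                 (cong +_ (trans (cong (λ t → path t i) (twice-+ i (suc j))) (path-multiset i (twice (suc j))))))
    exponent : ∀ k → twice (k N.+ suc j) ∸ 2 ≡ twice k N.+ twice j
    exponent k = cong (_∸ 2) (trans (twice-+ k (suc j)) (trans (NP.+-suc (twice k) (suc (twice j))) (cong suc (NP.+-suc (twice k) (twice j)))))
    factor : ∀ k → (sign k * + cyclic (k N.+ suc j) k) · (c ^ˢ (twice (k N.+ suc j) ∸ 2)) ≈ (s k · (c ^ˢ twice k)) ⊛ P
    factor k m = trans (cong₂ (λ x e → (sign k * x) * (c ^ˢ e) m) (cyclic-multiset k) (exponent k))
                       (trans (cong (s k *_) (^ˢ-+ c (twice k) (twice j) m)) (sym (·-⊛ (s k) (c ^ˢ twice k) P m)))

  diagonal-zero : diagonal 0 ≈ oneS ⊕ (- (+ 2)) · X (Q 1)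
  diagonal-zero = ≈-trans (SX-split (λ k → (sign k * + cyclic (k N.+ 0) k) · (c ^ˢ (twice (k N.+ 0) ∸ 2))))
                  (⊕-cong (λ m → ZP.*-identityˡ (oneS m))
                  (≈-trans (X-cong (SX-cong term)) (≈-trans (X-cong (SX-· (- (+ 2)) (λ i → (sign i * + multiset 1 i) · (c ^ˢ twice i)))) (X-· (- (+ 2)) (Q 1)))))
    where
    term : ∀ i → (sign (suc i) * + cyclic (suc i N.+ 0) (suc i)) · (c ^ˢ (twice (suc i N.+ 0) ∸ 2)) ≈ (- (+ 2)) · ((sign i * + multiset 1 i) · (c ^ˢ twice i))
    term i m rewrite NP.+-identityʳ i | path-diagonal (suc i) | path-diagonal i | multiset-one i = regroup (sign i) ((c ^ˢ twice i) m)
      where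
      regroup : ∀ s c → -1ℤ * s * + 2 * c ≡ - (+ 2) * (s * + 1 * c)
      regroup = solve-∀

  U₊ : ℕ → ℤ
  U₊ zero    = + 0
  U₊ (suc n) = + U (suc n)

  -- Φ agrees with U₊ except at n = 0, 1 (where U₊ = 0, Φ = 1, -1).
  correction : ℕ → ℤ
  correction zero          = - (+ 1)
  correction (suc zero)    = + 1
  correction (suc (suc n)) = + 0

  U₊≡Φ+correction : ∀ n → U₊ n ≡ Φ n + correction n
  U₊≡Φ+correction zero          = refl
  U₊≡Φ+correction (suc zero)    = refl
  U₊≡Φ+correction (suc (suc n)) = trans (U-formula n) (sym (ZP.+-identityʳ _))

  -- Σ_{n≥1} Uₙ xⁿ c^{2n-2}, with c^{2n-2} read as 1 for n = 0.
  U-series : Ser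
  U-series = SX (λ n → U₊ n · (c ^ˢ (twice n ∸ 2)))

  U-series-via-Φ : U-series ≈ SX (λ n → Φ n · (c ^ˢ (twice n ∸ 2))) ⊕ (X oneS ⊕ -1ℤ · oneS)
  U-series-via-Φ = begin
    U-series
      ≈⟨ SX-cong (λ n m → trans (cong (_* P n m) (U₊≡Φ+correction n)) (ZP.*-distribʳ-+ (P n m) (Φ n) (correction n))) ⟩
    SX (λ n → Φ n · P n ⊕ correction n · P n)
      ≈⟨ SX-⊕ (λ n → Φ n · P n) (λ n → correction n · P n) ⟩
    SX (λ n → Φ n · P n) ⊕ SX (λ n → correction n · P n)
      ≈⟨ ⊕-cong (≈-refl {SX (λ n → Φ n · P n)}) corrections ⟩
    SX (λ n → Φ n · P n) ⊕ (X oneS ⊕ -1ℤ · oneS) ∎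
    where
    open ≈-Reasoning
    P : ℕ → Ser
    P n = c ^ˢ (twice n ∸ 2)
    corrections : SX (λ n → correction n · P n) ≈ X oneS ⊕ -1ℤ · oneS
    corrections m = trans (SX-split (λ n → correction n · P n) m)
                   (trans (cong (λ t → -1ℤ * oneS m + t) (X-cong (≈-trans (SX-split (λ n → correction (suc n) · P (suc n)))
                                                          (⊕-cong (λ m → ZP.*-identityˡ (oneS m)) (X-cong (λ m → Σ-zero m _ (λ i → ZP.*-zeroˡ (P (suc (suc i)) (m ∸ i)))))))
                                                   m))
                   (trans (cong (λ t → -1ℤ * oneS m + t) (rest m)) (ZP.+-comm (-1ℤ * oneS m) (X oneS m))))
      where
      rest : X (oneS ⊕ X zeroS) ≈ X oneS
      rest zero          = refl
      rest (suc zero)    = ZP.+-identityʳ (+ 1)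
      rest (suc (suc m)) = refl

  higher-factorials : Ser
  higher-factorials = X (SX (λ j → factorials (suc j) · oneS))

  factorials-split : factorials ≈ oneS ⊕ higher-factorials
  factorials-split = ≈-trans (≈-sym (⊛-one factorials))
                     (≈-trans (SX-split (λ j → factorials j · oneS)) (⊕-cong {f′ = oneS} (λ m → ZP.*-identityˡ (oneS m)) (≈-refl {higher-factorials})))

  ∂c-times-Φ-series : ∂ c ⊛ SX (λ n → Φ n · (c ^ˢ (twice n ∸ 2))) ≈ ∂ c ⊕ (- (+ 2)) · X (∂ c ⊛ Q 1) ⊕ higher-factorials
  ∂c-times-Φ-series = begin
    ∂ c ⊛ SX (λ n → Φ n · (c ^ˢ (twice n ∸ 2)))     ≈⟨ ⊛-congʳ (∂ c) Φ-series-by-difference ⟩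
    ∂ c ⊛ SX (λ j → factorials j · diagonal j)      ≈⟨ ⊛-comm (∂ c) (SX (λ j → factorials j · diagonal j)) ⟩
    SX (λ j → factorials j · diagonal j) ⊛ ∂ c      ≈⟨ SX-⊛ (λ j → factorials j · diagonal j) (∂ c) ⟩
    SX (λ j → (factorials j · diagonal j) ⊛ ∂ c)    ≈⟨ SX-cong (λ j → ≈-trans (·-⊛ (factorials j) (diagonal j) (∂ c)) (·-cong (factorials j) (⊛-comm (diagonal j) (∂ c)))) ⟩
    SX (λ j → factorials j · (∂ c ⊛ diagonal j))    ≈⟨ SX-split (λ j → factorials j · (∂ c ⊛ diagonal j)) ⟩
    + 1 · (∂ c ⊛ diagonal 0) ⊕ X (SX (λ j → factorials (suc j) · (∂ c ⊛ diagonal (suc j))))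
      ≈⟨ ⊕-cong {f′ = ∂ c ⊛ diagonal 0} (λ m → ZP.*-identityˡ _) (X-cong (SX-cong (λ j → ·-cong (factorials (suc j)) (∂c-times-diagonal j)))) ⟩
    ∂ c ⊛ diagonal 0 ⊕ higher-factorials             ≈⟨ ⊕-cong (⊛-congʳ (∂ c) diagonal-zero) (≈-refl {higher-factorials}) ⟩
    ∂ c ⊛ (oneS ⊕ (- (+ 2)) · X (Q 1)) ⊕ higher-factorials
      ≈⟨ ⊕-cong (⊛-distribˡ oneS ((- (+ 2)) · X (Q 1)) (∂ c)) (≈-refl {higher-factorials}) ⟩
    ∂ c ⊛ oneS ⊕ ∂ c ⊛ ((- (+ 2)) · X (Q 1)) ⊕ higher-factorials
      ≈⟨ ⊕-cong (⊕-cong (⊛-one (∂ c)) (≈-trans (⊛-· (- (+ 2)) (∂ c) (X (Q 1))) (·-cong (- (+ 2)) (⊛-X (∂ c) (Q 1))))) (≈-refl {higher-factorials}) ⟩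
    ∂ c ⊕ (- (+ 2)) · X (∂ c ⊛ Q 1) ⊕ higher-factorials ∎
    where open ≈-Reasoning

  xc²-via-∂c : ∀ m → X (c ⊛ c) m ≡ + 2 * X (∂ c ⊛ Q 1) m - X (∂ c) m
  xc²-via-∂c zero    = refl
  xc²-via-∂c (suc m) = trans (sym (∂c-times-[2Q₁-1] m))
    (trans (⊛-distribˡ-⊖ (+ 2 · Q 1) oneS (∂ c) m) (cong₂ _-_ (⊛-· (+ 2) (∂ c) (Q 1) m) (⊛-one (∂ c) m)))

  -- Coefficientwise over ℤ: c + c' U-series equals
  -- (1 + x (2c'Q₁ - c')) + (c' - 2x c'Q₁ + Σ_{j≥1} j! xʲ) + (x c' - c') = Σ n! xⁿ.
  ordinary-identity : ∀ m → + (m !) ≡ c m + (∂ c ⊛ U-series) m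
  ordinary-identity m = sym (begin
    c m + (∂ c ⊛ U-series) m
      ≡⟨ cong₂ _+_ (catalan-equation m) (⊛-congʳ (∂ c) U-series-via-Φ m) ⟩
    oneS m + X (c ⊛ c) m + (∂ c ⊛ (ΦS ⊕ (X oneS ⊕ -1ℤ · oneS))) m
      ≡⟨ cong₂ (λ s t → oneS m + s + t) (xc²-via-∂c m) (trans (⊛-distribˡ ΦS (X oneS ⊕ -1ℤ · oneS) (∂ c) m) (cong₂ _+_ (∂c-times-Φ-series m) (corrections m))) ⟩
    oneS m + (+ 2 * X (∂ c ⊛ Q 1) m - X (∂ c) m) + ((∂ c m + - (+ 2) * X (∂ c ⊛ Q 1) m + higher-factorials m) + (X (∂ c) m + -1ℤ * ∂ c m))
      ≡⟨ cancel (oneS m) (X (∂ c ⊛ Q 1) m) (X (∂ c) m) (∂ c m) (higher-factorials m) ⟩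
    oneS m + higher-factorials m
      ≡⟨ sym (factorials-split m) ⟩
    + (m !) ∎)
    where
    open ≡-Reasoning
    ΦS = SX (λ n → Φ n · (c ^ˢ (twice n ∸ 2)))
    corrections : ∂ c ⊛ (X oneS ⊕ -1ℤ · oneS) ≈ X (∂ c) ⊕ -1ℤ · ∂ c
    corrections k = trans (⊛-distribˡ (X oneS) (-1ℤ · oneS) (∂ c) k)
      (cong₂ _+_ (trans (⊛-X (∂ c) oneS k) (X-cong (⊛-one (∂ c)) k)) (trans (⊛-· -1ℤ (∂ c) oneS k) (cong (-1ℤ *_) (⊛-one (∂ c) k))))
    cancel : ∀ a q x d r → a + (+ 2 * q - x) + ((d + - (+ 2) * q + r) + (x + -1ℤ * d)) ≡ a + r
    cancel = solve-∀

  ι : Defs.Series → Ser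
  ι f m = + f m

  ι-sumTo : ∀ m g → + Defs.sumTo m g ≡ Σ m (λ i → + g i)
  ι-sumTo zero    g = refl
  ι-sumTo (suc m) g = trans (ZP.pos-+ (Defs.sumTo m g) (g (suc m))) (cong (_+ + g (suc m)) (ι-sumTo m g))

  ι-⊛ : ∀ f g → ι (f Defs.⊛ g) ≈ ι f ⊛ ι g
  ι-⊛ f g m = trans (ι-sumTo m _) (Σ-cong m (λ i → ZP.pos-* (f i) (g (m ∸ i))))

  ι-^ : ∀ f n → ι (f Defs.^ˢ n) ≈ ι f ^ˢ n
  ι-^ f zero    zero    = refl
  ι-^ f zero    (suc m) = refl
  ι-^ f (suc n)         = ≈-trans (ι-⊛ f (f Defs.^ˢ n)) (⊛-congʳ (ι f) (ι-^ f n))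

  ι-∂ : ι (Defs.deriv Defs.c) ≈ ∂ c
  ι-∂ k = ZP.pos-* (suc k) (Defs.c (suc k))

  xPow-≤ : ∀ n f m → n ≤ m → Defs.xPow n f m ≡ f (m ∸ n)
  xPow-≤ n f m le with n ≤ᵇ m | NP.≤⇒≤ᵇ le
  ... | true | _ = refl

  twice≡ : ∀ n → twice n ≡ 2 N.* n
  twice≡ zero    = refl
  twice≡ (suc n) = trans (cong (λ t → suc (suc t)) (twice≡ n)) (sym (NP.*-suc 2 n))

  V-family U-family : ℕ → Defs.Series
  V-family n = V n Defs.∙ (Defs.c Defs.^ˢ (2 N.* n N.+ 1))
  U-family n = U n Defs.∙ (Defs.c Defs.^ˢ (2 N.* n ∸ 2))

  straight-theorem : ∀ m → Defs.factSeries m ≡ Defs.sumXFamily V-family m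
  straight-theorem m = ZP.+-injective (begin
    + (m !)                                                        ≡⟨ straight-identity m ⟩
    Σ m (λ n → + V n * (c ^ˢ suc (twice n)) (m ∸ n))               ≡⟨ sym (Σ-cong-≤ m term) ⟩
    Σ m (λ n → + Defs.xPow n (V-family n) m)  ≡⟨ sym (ι-sumTo m _) ⟩
    + Defs.sumXFamily V-family m  ∎)
    where
    open ≡-Reasoning
    exponent : ∀ n → 2 N.* n N.+ 1 ≡ suc (twice n)
    exponent n = trans (NP.+-comm (2 N.* n) 1) (cong suc (sym (twice≡ n)))
    term : ∀ n → n ≤ m → + Defs.xPow n (V-family n) m ≡ + V n * (c ^ˢ suc (twice n)) (m ∸ n)
    term n le = trans (cong +_ (xPow-≤ n (V-family n) m le)) (trans (ZP.pos-* (V n) ((Defs.c Defs.^ˢ (2 N.* n N.+ 1)) (m ∸ n)))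
                (cong (+ V n *_) (trans (ι-^ Defs.c (2 N.* n N.+ 1) (m ∸ n)) (cong (λ e → (c ^ˢ e) (m ∸ n)) (exponent n)))))

  ι-U-series : ι (Defs.sumXFamily₁ U-family) ≈ U-series
  ι-U-series t = trans (ι-sumTo t _) (Σ-cong-≤ t term)
    where
    term : ∀ n → n ≤ t → + (if n ≡ᵇ 0 then 0 else Defs.xPow n (U-family n) t) ≡ U₊ n * (c ^ˢ (twice n ∸ 2)) (t ∸ n)
    term zero    _  = sym (ZP.*-zeroˡ ((c ^ˢ 0) t))
    term (suc n) le = trans (cong +_ (xPow-≤ (suc n) (U-family (suc n)) t le)) (trans (ZP.pos-* (U (suc n)) ((Defs.c Defs.^ˢ (2 N.* suc n ∸ 2)) (t ∸ suc n)))
                      (cong (+ U (suc n) *_) (trans (ι-^ Defs.c (2 N.* suc n ∸ 2) (t ∸ suc n)) (cong (λ e → (c ^ˢ (e ∸ 2)) (t ∸ suc n)) (sym (twice≡ (suc n)))))))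

  ordinary-theorem : ∀ m → Defs.factSeries m ≡ (Defs.c Defs.⊕ (Defs.deriv Defs.c Defs.⊛ Defs.sumXFamily₁ U-family)) m
  ordinary-theorem m = ZP.+-injective (begin
    + (m !)                         ≡⟨ ordinary-identity m ⟩
    c m + (∂ c ⊛ U-series) m        ≡⟨ cong (λ t → c m + t) (sym (⊛-cong ι-∂ ι-U-series m)) ⟩
    c m + (ι (Defs.deriv Defs.c) ⊛ ι S) m  ≡⟨ cong (λ t → c m + t) (sym (ι-⊛ (Defs.deriv Defs.c) S m)) ⟩
    + Defs.c m + + (Defs.deriv Defs.c Defs.⊛ S) m  ≡⟨ sym (ZP.pos-+ (Defs.c m) _) ⟩
    + (Defs.c Defs.⊕ (Defs.deriv Defs.c Defs.⊛ S)) m ∎)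
    where
    open ≡-Reasoning
    S = Defs.sumXFamily₁ U-family

open import Defs
open import Data.Nat.Base using (ℕ; suc; _+_; _*_; _∸_)
open import Data.Product.Base using (_×_; _,_)
open import Relation.Binary.PropositionalEquality using (_≡_)

theorem1 : (∀ m → factSeries m ≡ sumXFamily (λ n → V n ∙ (c ^ˢ (2 * n + 1))) m)
    × (∀ m → factSeries m ≡ (c ⊕ (deriv c ⊛ sumXFamily₁ (λ n → U n ∙ (c ^ˢ (2 * n ∸ 2))))) m)
theorem1 = Proof.straight-theorem , Proof.ordinary-theorem
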